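{- Let $G$ be a graph of order $n\geq 2$ with $\nu_2(\overline{G^2})=p$. Then for every $t\geq 2$, $\lambda(M^t(G))\leq 2^{t-1}(2n-p+2)-2$.
   Context: Graphs are finite, simple, undirected. $G^2$ is the square of $G$: same vertex set, with $xy$ an edge iff $1\le d_G(x,y)\le 2$; $\overline{G^2}$ is its complement (so $xy$ is an edge of $\overline{G^2}$ iff $d_G(x,y)\ge 3$, including infinite distance). A 2-matching of a graph $H$ is an assignment of weights $0,1,2$ to the edges of $H$ such that the sum of weights of edges incident to each vertex is at most 2; its size is the total weight, and $\nu_2(H)$ is the maximum size of a 2-matching of $H$. An $L(2,1)$-labeling of $G$ is a map $f:V\to\{0,1,2,\dots\}$ with $|f(x)-f(y)|\ge 2$ if $d_G(x,y)=1$ and $|f(x)-f(y)|\ge1$ if $d_G(x,y)=2$; $\lambda(G)$ is the minimum over such $f$ of the largest label. For $V=\{v_1,\dots,v_n\}$, $M(G)$ has vertex set $V\cup\{v_1',\dots,v_n'\}\cup\{u\}$ and edge set $E\cup\{v_iv_j' : v_iv_j\in E\}\cup\{v_i'u: 1\le i\le n\}$; $M^0(G)=G$, $M^t(G)=M(M^{t-1}(G))$. -}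

module Defs where

open import Data.Bool using (Bool; true; false; T)
open import Data.Nat using (ℕ; zero; suc; _+_; _*_; _≤_; _<_)
open import Data.Fin using (Fin; zero; suc; toℕ; splitAt)
open import Data.Sum using (_⊎_; inj₁; inj₂)
open import Data.Product using (Σ; ∃; _×_; _,_)
open import Relation.Nullary using (¬_)
open import Relation.Binary.PropositionalEquality using (_≡_; refl)

record Graph (n : ℕ) : Set where
  field
    adj   : Fin n → Fin n → Bool
    sym   : ∀ x y → adj x y ≡ adj y x
    irrefl : ∀ x → adj x x ≡ false
open Graph public

Adj : ∀ {n} → Graph n → Fin n → Fin n → Set
Adj G x y = T (adj G x y)

Dist2 : ∀ {n} → Graph n → Fin n → Fin n → Set
Dist2 G x y = ¬ (x ≡ y) × ¬ Adj G x y × ∃ λ z → Adj G x z × Adj G z y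

-- d_G(x,y) ≥ 3 (including ∞): distinct, non-adjacent, no common neighbour.
-- This is exactly the adjacency of the complement of the square of G.
Far : ∀ {n} → Graph n → Fin n → Fin n → Set
Far G x y = ¬ (x ≡ y) × ¬ Adj G x y × ¬ (∃ λ z → Adj G x z × Adj G z y)

sumFin : ∀ {n} → (Fin n → ℕ) → ℕ
sumFin {zero}  f = 0
sumFin {suc n} f = f zero + sumFin (λ i → f (suc i))

-- A 2-matching of the complement of G² , given as a symmetric weight
-- function on ordered pairs of vertices (the weight of edge xy is w x y = w y x).
record TwoMatchingCompSq {n} (G : Graph n) : Set where
  field
    w        : Fin n → Fin n → ℕ
    w-sym    : ∀ x y → w x y ≡ w y x
    w-le2    : ∀ x y → w x y ≤ 2
    w-edge   : ∀ x y → ¬ Far G x y → w x y ≡ 0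
    w-vertex : ∀ x → sumFin (λ y → w x y) ≤ 2
open TwoMatchingCompSq public

size : ∀ {n} {G : Graph n} → TwoMatchingCompSq G → ℕ
size {n} m = sumFin (λ x → sumFin (λ y → pick (toℕ x Data.Nat.<ᵇ toℕ y) (w m x y)))
  where
    pick : Bool → ℕ → ℕ
    pick true  k = k
    pick false _ = 0

Nu2CompSq : ∀ {n} → Graph n → ℕ → Set
Nu2CompSq G p =
  (Σ (TwoMatchingCompSq G) λ m → size m ≡ p) ×
  (∀ (m : TwoMatchingCompSq G) → size m ≤ p)

IsL21 : ∀ {n} → Graph n → (Fin n → ℕ) → Set
IsL21 G f =
  (∀ x y → Adj G x y → (f x + 2 ≤ f y) ⊎ (f y + 2 ≤ f x)) ×
  (∀ x y → Dist2 G x y → (f x < f y) ⊎ (f y < f x))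

LambdaAtMost : ∀ {n} → Graph n → ℕ → Set
LambdaAtMost G k = Σ (_ → ℕ) λ f → IsL21 G f × (∀ x → f x ≤ k)

-- Mycielski construction.  Vertices of M(G) are Fin (suc (n + n)):
-- zero is u, suc (i ↑ˡ n) is v_i, suc (n ↑ʳ i) is v_i'.
data Kind (n : ℕ) : Set where
  hub  : Kind n
  orig : Fin n → Kind n
  copy : Fin n → Kind n

kind : ∀ {n} → Fin (suc (n + n)) → Kind n
kind zero = hub
kind {n} (suc x) with splitAt n x
... | inj₁ i = orig i
... | inj₂ i = copy i

adjK : ∀ {n} → Graph n → Kind n → Kind n → Bool
adjK G hub      hub      = false
adjK G hub      (orig j) = false
adjK G hub      (copy j) = true
adjK G (orig i) hub      = false
adjK G (orig i) (orig j) = adj G i j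
adjK G (orig i) (copy j) = adj G i j
adjK G (copy i) hub      = true
adjK G (copy i) (orig j) = adj G i j
adjK G (copy i) (copy j) = false

adjK-sym : ∀ {n} (G : Graph n) a b → adjK G a b ≡ adjK G b a
adjK-sym G hub      hub      = refl
adjK-sym G hub      (orig j) = refl
adjK-sym G hub      (copy j) = refl
adjK-sym G (orig i) hub      = refl
adjK-sym G (orig i) (orig j) = sym G i j
adjK-sym G (orig i) (copy j) = sym G i j
adjK-sym G (copy i) hub      = refl
adjK-sym G (copy i) (orig j) = sym G i j
adjK-sym G (copy i) (copy j) = refl

adjK-irr : ∀ {n} (G : Graph n) a → adjK G a a ≡ false
adjK-irr G hub      = refl
adjK-irr G (orig i) = irrefl G i
adjK-irr G (copy i) = refl

M : ∀ {n} → Graph n → Graph (suc (n + n))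
M G = record
  { adj    = λ x y → adjK G (kind x) (kind y)
  ; sym    = λ x y → adjK-sym G (kind x) (kind y)
  ; irrefl = λ x → adjK-irr G (kind x)
  }

ordM : ℕ → ℕ → ℕ
ordM zero    n = n
ordM (suc t) n = suc (ordM t n + ordM t n)

Mpow : ∀ {n} (t : ℕ) → Graph n → Graph (ordM t n)
Mpow zero    G = G
Mpow (suc t) G = M (Mpow t G)

module Submission where

-- Let H have a levelling of height b (see Levelling). In M(H), level a of H splits into
-- the labels 2a and 2a + 1, a vertex and its copy taking different ones, and the hub gets
-- 2b + 2; this is an L(2,1)-labelling of M(H) and again a levelling. Hence, once M(G)
-- has a levelling of height b, λ(M^t(G)) ≤ 2^(t−1)(b + 2) − 2.
--
-- A levelling of M(G) of height b ≤ 2n − p comes from a maximum 2-matching of the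
-- complement of G², which splits into paths and cycles of vertices pairwise at distance
-- ≥ 3 in G. A path x₀ … x_k gives the levels {x₀}, {x₁, x₀′}, …, {x_k, x_{k−1}′}, {x_k′},
-- a cycle x₁ … x_k the levels {x₂, x₁′}, …, {x₁, x_k′}, and the hub comes last; a path on
-- k vertices uses k + 1 levels and a cycle k, 2n − p in total. Consecutive blocks fit
-- because an odd cycle can be rotated to start at a vertex adjacent to neither vertex of
-- the next level, while even cycles are cut into double edges, whose two levels can be
-- arranged to suit the next level.

open import Defs renaming (sym to adj-sym)
open import Data.Bool using (Bool; true; false; T; not; _xor_; f≤t; b≤b) renaming (_≤_ to _≤ᵇ_)
open import Data.Bool.Properties using (not-injective; not-¬; not-involutive; not-distribˡ-xor; not-distribʳ-xor)
open import Data.Nat using (ℕ; zero; suc; pred; _+_; _*_; _^_; _∸_; _≤_; _<_; _<ᵇ_; z≤n; s≤s; _≟_; >-nonZero)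
open import Data.Nat.Properties
open import Data.Nat.ListAction using (sum)
open import Data.Nat.ListAction.Properties using (sum-++)
open import Data.Nat.Tactic.RingSolver using (solve-∀)
open import Data.Fin using (Fin; zero; suc; toℕ; splitAt; join; _↑ˡ_; _↑ʳ_)
import Data.Fin as Fin
open import Data.Fin.Properties using (join-splitAt; toℕ-injective; toℕ<n) renaming (_≟_ to _≟ᶠ_)
import Data.Fin.Properties as Finₚ
open import Data.List using (List; []; _∷_; length; _++_; map; filter; lookup; allFin)
open import Data.List.Properties
  using (filter-notAll; map-++; length-++; length-++-comm; length-++-sucʳ; ++-assoc; length-tabulate)
open import Data.List.Membership.Propositional using (_∈_; find; lose)
open import Data.List.Membership.Propositional.Properties
  using (∈-filter⁺; ∈-allFin; ∈-lookup; ∈-∃++; ∈-++⁺ˡ; ∈-++⁺ʳ; ∈-++⁻)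
open import Data.List.Relation.Unary.Any using (Any; here; there; any?)
import Data.List.Relation.Unary.Any as Any
import Data.List.Relation.Unary.Any.Properties as Any
open import Data.List.Relation.Unary.All using (All; []; _∷_)
import Data.List.Relation.Unary.All as All
import Data.List.Relation.Unary.All.Properties as All
open import Data.Sum using (_⊎_; inj₁; inj₂; swap)
open import Data.Product using (∃; _×_; _,_; proj₁; proj₂)
open import Data.Empty using (⊥-elim)
open import Data.Unit using (⊤; tt)
open import Function using (_∘_; id)
open import Relation.Nullary using (¬_; yes; no; Dec; ¬?; _×-dec_; _⊎-dec_)
open import Relation.Nullary.Decidable using (T?)
open import Relation.Binary.Definitions using (tri<; tri≈; tri>)
open import Relation.Binary.PropositionalEquality


double+bit : ℕ → Bool → ℕ
double+bit zero    false = 0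
double+bit zero    true  = 1
double+bit (suc a) x     = suc (suc (double+bit a x))

double+bit-injective : ∀ a c {x y} → double+bit a x ≡ double+bit c y → a ≡ c × x ≡ y
double+bit-injective zero    zero    {false} {false} _ = refl , refl
double+bit-injective zero    zero    {true}  {true}  _ = refl , refl
double+bit-injective zero    zero    {false} {true}  ()
double+bit-injective zero    zero    {true}  {false} ()
double+bit-injective zero    (suc c) {false} ()
double+bit-injective zero    (suc c) {true}  ()
double+bit-injective (suc a) zero    {_} {false} ()
double+bit-injective (suc a) zero    {_} {true}  ()
double+bit-injective (suc a) (suc c) eq with double+bit-injective a c (suc-injective (suc-injective eq))
... | refl , x≡y = refl , x≡y

double+bit-monoʳ-≤ : ∀ a {x y} → x ≤ᵇ y → double+bit a x ≤ double+bit a y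
double+bit-monoʳ-≤ zero    f≤t = z≤n
double+bit-monoʳ-≤ zero    b≤b = ≤-refl
double+bit-monoʳ-≤ (suc a) x≤y = s≤s (s≤s (double+bit-monoʳ-≤ a x≤y))

double+bit-monoˡ-< : ∀ {a c} x y → a < c → double+bit a x < double+bit c y
double+bit-monoˡ-< {zero}  {suc c} false y _ = s≤s z≤n
double+bit-monoˡ-< {zero}  {suc c} true  y _ = s≤s (s≤s z≤n)
double+bit-monoˡ-< {suc a} {suc c} x y (s≤s a<c) = s≤s (s≤s (double+bit-monoˡ-< x y a<c))

double+bit-suc : ∀ a x → double+bit a x + 2 ≡ double+bit (suc a) x
double+bit-suc a x = +-comm (double+bit a x) 2

double+bit-false : ∀ a → double+bit a false ≡ 2 * a
double+bit-false zero    = refl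
double+bit-false (suc a) = begin
  suc (suc (double+bit a false)) ≡⟨ cong (2 +_) (double+bit-false a) ⟩
  suc (suc (2 * a))        ≡⟨ sym (*-distribˡ-+ 2 1 a) ⟩
  2 * suc a                ∎
  where open ≡-Reasoning

TwoApart : ℕ → ℕ → Set
TwoApart u v = u + 2 ≤ v ⊎ v + 2 ≤ u

TwoApart⇒≢ : ∀ {u v} → TwoApart u v → u ≢ v
TwoApart⇒≢ {u} (inj₁ u+2≤u) refl = m+1+n≰m u u+2≤u
TwoApart⇒≢ {u} (inj₂ u+2≤u) refl = m+1+n≰m u u+2≤u

TwoApart⇒≢suc : ∀ {u v} → TwoApart u v → v ≢ suc u
TwoApart⇒≢suc {u} (inj₁ u+2≤v) refl = 1+n≰n (≤-trans (≤-reflexive (+-comm 2 u)) u+2≤v)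
TwoApart⇒≢suc {u} (inj₂ v+2≤u) refl = 1+n≰n (≤-trans (m≤m+n (suc u) 2) v+2≤u)

double+bit-gap : ∀ {a c x y} → a < c → (c ≡ suc a → x ≤ᵇ y) → double+bit a x + 2 ≤ double+bit c y
double+bit-gap {a} {c} {x} {y} a<c adjacent-levels = begin
  double+bit a x + 2   ≡⟨ double+bit-suc a x ⟩
  double+bit (suc a) x ≤⟨ next a<c ⟩
  double+bit c y       ∎
  where
  open ≤-Reasoning
  next : suc a ≤ c → double+bit (suc a) x ≤ double+bit c y
  next sa≤c with m≤n⇒m<n∨m≡n sa≤c
  ... | inj₁ sa<c = <⇒≤ (double+bit-monoˡ-< x y sa<c)
  ... | inj₂ refl = double+bit-monoʳ-≤ (suc a) (adjacent-levels refl)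

double+bit-separated : ∀ {a c x y} → a ≢ c → (c ≡ suc a → x ≤ᵇ y) → (a ≡ suc c → y ≤ᵇ x) →
                 TwoApart (double+bit a x) (double+bit c y)
double+bit-separated {a} {c} a≢c up down with <-cmp a c
... | tri< a<c _ _ = inj₁ (double+bit-gap a<c up)
... | tri≈ _ a≡c _ = ⊥-elim (a≢c a≡c)
... | tri> _ _ c<a = inj₂ (double+bit-gap c<a down)

≢⇒<⊎> : ∀ {u v} → u ≢ v → u < v ⊎ v < u
≢⇒<⊎> {u} {v} u≢v with <-cmp u v
... | tri< u<v _ _ = inj₁ u<v
... | tri≈ _ u≡v _ = ⊥-elim (u≢v u≡v)
... | tri> _ _ v<u = inj₂ v<u

false≤ᵇ : ∀ {x} y → x ≡ false → x ≤ᵇ y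
false≤ᵇ false refl = b≤b
false≤ᵇ true  refl = f≤t

≤ᵇtrue : ∀ x {y} → y ≡ true → x ≤ᵇ y
≤ᵇtrue false refl = f≤t
≤ᵇtrue true  refl = b≤b

module _ {n : ℕ} where

  vertex : Kind n → Fin (suc (n + n))
  vertex hub      = zero
  vertex (orig i) = suc (i ↑ˡ n)
  vertex (copy i) = suc (n ↑ʳ i)

  vertex-kind : ∀ x → vertex (kind {n} x) ≡ x
  vertex-kind zero = refl
  vertex-kind (suc x) with splitAt n x in eq
  ... | inj₁ i = cong Fin.suc (trans (cong (join n n) (sym eq)) (join-splitAt n n x))
  ... | inj₂ i = cong Fin.suc (trans (cong (join n n) (sym eq)) (join-splitAt n n x))

  kind-injective : ∀ x y → kind {n} x ≡ kind y → x ≡ y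
  kind-injective x y eq = trans (sym (vertex-kind x)) (trans (cong vertex eq) (vertex-kind y))

Close : ∀ {N} → Graph N → Fin N → Fin N → Set
Close H x y = Adj H x y ⊎ Dist2 H x y

adj-swap : ∀ {N} (H : Graph N) {x y} → Adj H x y → Adj H y x
adj-swap H {x} {y} = subst T (adj-sym H x y)

module _ {n : ℕ} (G : Graph n) where

  KAdj : Kind n → Kind n → Set
  KAdj k k' = T (adjK G k k')

  KDist2 : Kind n → Kind n → Set
  KDist2 k k' = k ≢ k' × ¬ KAdj k k' × ∃ λ k'' → KAdj k k'' × KAdj k'' k'

  KClose : Kind n → Kind n → Set
  KClose k k' = KAdj k k' ⊎ KDist2 k k'

  kadj-swap : ∀ k k' → KAdj k k' → KAdj k' k
  kadj-swap k k' = subst T (adjK-sym G k k')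

  Dist2⇒KDist2 : ∀ {x y} → Dist2 (M G) x y → KDist2 (kind x) (kind y)
  Dist2⇒KDist2 {x} {y} (x≢y , nonadj , z , xz , zy) =
    (x≢y ∘ kind-injective x y) , nonadj , kind z , xz , zy

  Close⇒KClose : ∀ {x y} → Close (M G) x y → KClose (kind x) (kind y)
  Close⇒KClose (inj₁ xy)    = inj₁ xy
  Close⇒KClose (inj₂ dist2) = inj₂ (Dist2⇒KDist2 dist2)

  common-neighbour-orig : ∀ {i j} k → KAdj (orig i) k → KAdj k (orig j) →
                          ∃ λ l → Adj G i l × Adj G l j
  common-neighbour-orig (orig l) il lj = l , il , lj
  common-neighbour-orig (copy l) il lj = l , il , lj

  common-neighbour-orig-copy : ∀ {i j} k → KAdj (orig i) k → KAdj k (copy j) →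
                               ∃ λ l → Adj G i l × Adj G l j
  common-neighbour-orig-copy (orig l) il lj = l , il , lj

-- Levellings and the doubling step

-- A levelling of H of height b groups the vertices into levels 0 … b of at most two
-- vertices each, told apart by the flag upper; vertices of one level are at distance ≥ 3,
-- an edge between consecutive levels runs from a non-upper vertex up to an upper one, and
-- the top level is upper.
record Levelling {N} (H : Graph N) (b : ℕ) : Set where
  field
    level        : Fin N → ℕ
    upper        : Fin N → Bool
    level≤       : ∀ x → level x ≤ b
    close⇒level≢ : ∀ x y → Close H x y → level x ≢ level y
    climb        : ∀ x y → Adj H x y → level y ≡ suc (level x) → upper x ≡ false × upper y ≡ true
    twins        : ∀ x y → level x ≡ level y → x ≢ y → upper x ≢ upper y
    top⇒upper    : ∀ x → level x ≡ b → upper x ≡ true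

module Doubling {N} {H : Graph N} {b : ℕ} (L : Levelling H b) where
  open Levelling L

  -- The copy of i gets the other bit than i, since both lie on level i.
  label : Kind N → ℕ
  label hub      = double+bit (suc b) false
  label (orig i) = double+bit (level i) (upper i)
  label (copy i) = double+bit (level i) (not (upper i))

  side : Kind N → Bool
  side hub      = true
  side (orig _) = false
  side (copy _) = true

  below-hub : ∀ i x → double+bit (level i) x < label hub
  below-hub i x = double+bit-monoˡ-< x false (s≤s (level≤ i))

  label≤ : ∀ k → label k ≤ label hub
  label≤ hub      = ≤-refl
  label≤ (orig i) = <⇒≤ (below-hub i _)
  label≤ (copy i) = <⇒≤ (below-hub i _)

  copy-hub-gap : ∀ i → label (copy i) + 2 ≤ label hub
  copy-hub-gap i = double+bit-gap (s≤s (level≤ i)) top-bit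
    where
    top-bit : suc b ≡ suc (level i) → not (upper i) ≤ᵇ false
    top-bit eq rewrite top⇒upper i (suc-injective (sym eq)) = b≤b

  adjacent-gap : ∀ k k' → KAdj H k k' → TwoApart (label k) (label k')
  adjacent-gap hub      (copy j) _  = inj₂ (copy-hub-gap j)
  adjacent-gap (copy i) hub      _  = inj₁ (copy-hub-gap i)
  adjacent-gap (orig i) (orig j) ij = double+bit-separated (close⇒level≢ i j (inj₁ ij))
    (λ up   → false≤ᵇ _ (proj₁ (climb i j ij up)))
    (λ down → false≤ᵇ _ (proj₁ (climb j i (adj-swap H ij) down)))
  adjacent-gap (orig i) (copy j) ij = double+bit-separated (close⇒level≢ i j (inj₁ ij))
    (λ up   → false≤ᵇ _ (proj₁ (climb i j ij up)))
    (λ down → ≤ᵇtrue _ (proj₂ (climb j i (adj-swap H ij) down)))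
  adjacent-gap (copy i) (orig j) ij with adjacent-gap (orig j) (copy i) (adj-swap H ij)
  ... | inj₁ gap = inj₂ gap
  ... | inj₂ gap = inj₁ gap

  distant-levels : ∀ i j x y → Dist2 H i j → double+bit (level i) x ≢ double+bit (level j) y
  distant-levels i j x y dist2 = close⇒level≢ i j (inj₂ dist2) ∘ proj₁ ∘ double+bit-injective _ _

  same-level : ∀ i x y → x ≢ y → double+bit (level i) x ≢ double+bit (level i) y
  same-level i x y x≢y = x≢y ∘ proj₂ ∘ double+bit-injective _ _

  distance-two : ∀ k k' → KDist2 H k k' → label k ≢ label k'
  distance-two (orig i) (orig j) (k≢k' , nonadj , m , im , mj) =
    distant-levels i j _ _ ((k≢k' ∘ cong orig) , nonadj , common-neighbour-orig H m im mj)
  distance-two (orig i) (copy j) (k≢k' , nonadj , m , im , mj) with i ≟ᶠ j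
  ... | yes refl = same-level i _ _ (not-¬ refl)
  ... | no i≢j   = distant-levels i j _ _ (i≢j , nonadj , common-neighbour-orig-copy H m im mj)
  distance-two (copy i) (orig j) (k≢k' , nonadj , m , im , mj) =
    distance-two (orig j) (copy i)
      ((k≢k' ∘ sym) , (nonadj ∘ kadj-swap H (orig j) (copy i)) , m ,
       kadj-swap H m (orig j) mj , kadj-swap H (copy i) m im) ∘ sym
  distance-two (copy i) (copy j) (k≢k' , _) eq
    with double+bit-injective (level i) (level j) eq
  ... | li≡lj , bits = twins i j li≡lj (k≢k' ∘ cong copy) (not-injective bits)
  distance-two hub      (orig j) _ = <⇒≢ (below-hub j _) ∘ sym
  distance-two (orig i) hub      _ = <⇒≢ (below-hub i _)
  distance-two hub      hub      (k≢k' , _) = ⊥-elim (k≢k' refl)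
  distance-two hub      (copy j) (_ , nonadj , _) = ⊥-elim (nonadj _)
  distance-two (copy i) hub      (_ , nonadj , _) = ⊥-elim (nonadj _)

  side-twins : ∀ k k' → label k ≡ label k' → k ≢ k' → side k ≢ side k'
  side-twins hub      hub      _  k≢k' = ⊥-elim (k≢k' refl)
  side-twins hub      (orig j) eq _    = ⊥-elim (<⇒≢ (below-hub j _) (sym eq))
  side-twins hub      (copy j) eq _    = ⊥-elim (<⇒≢ (below-hub j _) (sym eq))
  side-twins (orig i) hub      eq _    = ⊥-elim (<⇒≢ (below-hub i _) eq)
  side-twins (copy i) hub      eq _    = ⊥-elim (<⇒≢ (below-hub i _) eq)
  side-twins (orig i) (copy j) _  _    = λ ()
  side-twins (copy i) (orig j) _  _    = λ ()
  side-twins (orig i) (orig j) eq k≢k' with double+bit-injective (level i) (level j) eq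
  ... | li≡lj , bits = ⊥-elim (twins i j li≡lj (k≢k' ∘ cong orig) bits)
  side-twins (copy i) (copy j) eq k≢k' with double+bit-injective (level i) (level j) eq
  ... | li≡lj , bits = ⊥-elim (twins i j li≡lj (k≢k' ∘ cong copy) (not-injective bits))

  top-side : ∀ k → label k ≡ label hub → side k ≡ true
  top-side hub      _  = refl
  top-side (orig i) eq = ⊥-elim (<⇒≢ (below-hub i _) eq)
  top-side (copy i) _  = refl

  labelling : Fin (suc (N + N)) → ℕ
  labelling = label ∘ kind

  labelling-IsL21 : IsL21 (M H) labelling
  labelling-IsL21 = (λ x y xy → adjacent-gap (kind x) (kind y) xy)
                  , (λ x y dist2 → ≢⇒<⊎> (distance-two (kind x) (kind y) (Dist2⇒KDist2 H dist2)))

  lambda : LambdaAtMost (M H) (label hub)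
  lambda = labelling , labelling-IsL21 , label≤ ∘ kind

  close⇒label≢ : ∀ x y → Close (M H) x y → labelling x ≢ labelling y
  close⇒label≢ x y (inj₁ xy)    = TwoApart⇒≢ (adjacent-gap (kind x) (kind y) xy)
  close⇒label≢ x y (inj₂ dist2) = distance-two (kind x) (kind y) (Dist2⇒KDist2 H dist2)

  levelling : Levelling (M H) (label hub)
  levelling = record
    { level        = labelling
    ; upper        = side ∘ kind
    ; level≤       = label≤ ∘ kind
    ; close⇒level≢ = close⇒label≢
    ; climb        = λ x y xy step → ⊥-elim (TwoApart⇒≢suc (adjacent-gap (kind x) (kind y) xy) step)
    ; twins        = λ x y eq x≢y → side-twins (kind x) (kind y) eq (x≢y ∘ kind-injective x y)
    ; top⇒upper    = top-side ∘ kind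
    }

height : ℕ → ℕ → ℕ
height b zero    = b
height b (suc k) = double+bit (suc (height b k)) false

height+2 : ∀ b k → height b k + 2 ≡ 2 ^ k * (b + 2)
height+2 b zero    = sym (*-identityˡ (b + 2))
height+2 b (suc k) = begin
  double+bit (suc (height b k)) false + 2 ≡⟨ cong (_+ 2) (double+bit-false (suc (height b k))) ⟩
  2 * suc (height b k) + 2          ≡⟨ double-+2 (height b k) ⟩
  2 * (height b k + 2)              ≡⟨ cong (2 *_) (height+2 b k) ⟩
  2 * (2 ^ k * (b + 2))             ≡⟨ sym (*-assoc 2 (2 ^ k) (b + 2)) ⟩
  2 ^ suc k * (b + 2)               ∎
  where
  open ≡-Reasoning
  double-+2 : ∀ h → 2 * suc h + 2 ≡ 2 * (h + 2)
  double-+2 = solve-∀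

height-bound : ∀ {b p m} k → b + p ≤ m → height b k ≤ 2 ^ k * (m + 2 ∸ p) ∸ 2
height-bound {b} {p} {m} k b+p≤m = begin
  height b k                ≡⟨ sym (m+n∸n≡m (height b k) 2) ⟩
  height b k + 2 ∸ 2        ≡⟨ cong (_∸ 2) (height+2 b k) ⟩
  2 ^ k * (b + 2) ∸ 2       ≤⟨ ∸-monoˡ-≤ 2 (*-monoʳ-≤ (2 ^ k) (m+n≤o⇒m≤o∸n (b + 2) shifted)) ⟩
  2 ^ k * (m + 2 ∸ p) ∸ 2   ∎
  where
  open ≤-Reasoning
  shifted : b + 2 + p ≤ m + 2
  shifted = ≤-trans (≤-reflexive (swap-2 b p)) (+-monoˡ-≤ 2 b+p≤m)
    where
    swap-2 : ∀ b p → b + 2 + p ≡ b + p + 2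
    swap-2 = solve-∀

module _ {n} (G : Graph n) {b : ℕ} (L : Levelling (M G) b) where

  levelling-Mpow : ∀ k → Levelling (Mpow (suc k) G) (height b k)
  levelling-Mpow zero    = L
  levelling-Mpow (suc k) = Doubling.levelling (levelling-Mpow k)

  lambda-Mpow : ∀ k → LambdaAtMost (Mpow (suc (suc k)) G) (height b (suc k))
  lambda-Mpow k = Doubling.lambda (levelling-Mpow k)

lambda-mono : ∀ {N} (H : Graph N) {k k'} → k ≤ k' → LambdaAtMost H k → LambdaAtMost H k'
lambda-mono H k≤k' (f , l21 , f≤k) = f , l21 , λ x → ≤-trans (f≤k x) k≤k'

sumFin-cong : ∀ {n} {f g : Fin n → ℕ} → (∀ i → f i ≡ g i) → sumFin f ≡ sumFin g
sumFin-cong {zero}  _   = refl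
sumFin-cong {suc n} f≗g = cong₂ _+_ (f≗g zero) (sumFin-cong (f≗g ∘ suc))

sumFin-mono : ∀ {n} {f g : Fin n → ℕ} → (∀ i → f i ≤ g i) → sumFin f ≤ sumFin g
sumFin-mono {zero}  _   = z≤n
sumFin-mono {suc n} f≤g = +-mono-≤ (f≤g zero) (sumFin-mono (f≤g ∘ suc))

term≤sumFin : ∀ {n} (f : Fin n → ℕ) i → f i ≤ sumFin f
term≤sumFin f zero    = m≤m+n (f zero) _
term≤sumFin f (suc i) = ≤-trans (term≤sumFin (f ∘ suc) i) (m≤n+m _ (f zero))

sumFin-positive : ∀ {n} (f : Fin n → ℕ) → 0 < sumFin f → ∃ λ i → 0 < f i
sumFin-positive {suc n} f pos with f zero in eq
... | suc _ = zero , subst (0 <_) (sym eq) (s≤s z≤n)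
... | zero with sumFin-positive (f ∘ suc) pos
...   | i , fi>0 = suc i , fi>0

sumFin-zero : ∀ {n} {f : Fin n → ℕ} → (∀ i → f i ≡ 0) → sumFin f ≡ 0
sumFin-zero {zero}  _    = refl
sumFin-zero {suc n} f≗0 = cong₂ _+_ (f≗0 zero) (sumFin-zero (f≗0 ∘ suc))

sumFin-suc-at : ∀ {n} {f g : Fin n → ℕ} k → (∀ i → i ≢ k → f i ≡ g i) → f k ≡ suc (g k) →
                sumFin f ≡ suc (sumFin g)
sumFin-suc-at {suc n} zero f≗g fk =
  cong₂ _+_ fk (sumFin-cong (λ i → f≗g (suc i) (λ ())))
sumFin-suc-at {suc n} {f} {g} (suc k) f≗g fk = begin
  f zero + sumFin (f ∘ suc)        ≡⟨ cong₂ _+_ (f≗g zero (λ ()))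
                                        (sumFin-suc-at k (λ i i≢k → f≗g (suc i) (i≢k ∘ Finₚ.suc-injective)) fk) ⟩
  g zero + suc (sumFin (g ∘ suc))  ≡⟨ +-suc (g zero) _ ⟩
  suc (sumFin g)                   ∎
  where open ≡-Reasoning

module _ {A : Set} where

  last : A → List A → A
  last x []       = x
  last x (y ∷ ys) = last y ys

  last-∈ : ∀ x xs → last x xs ∈ x ∷ xs
  last-∈ x []       = here refl
  last-∈ x (y ∷ ys) = there (last-∈ y ys)

  Chain : (A → A → Set) → A → List A → Set
  Chain R x []       = ⊤
  Chain R x (y ∷ ys) = R x y × Chain R y ys

  lookup-chain : ∀ {R : A → A → Set} (x : A) xs (i j : Fin (suc (length xs))) → toℕ j ≡ suc (toℕ i) →
                 Chain R x xs → R (lookup (x ∷ xs) i) (lookup (x ∷ xs) j)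
  lookup-chain x (y ∷ ys) zero    (suc zero)    _  (xy , _)   = xy
  lookup-chain x (y ∷ ys) zero    (suc (suc j)) ()
  lookup-chain x (y ∷ ys) (suc i) (suc j)       eq (_ , chain) = lookup-chain y ys i j (suc-injective eq) chain
  lookup-chain x []       zero    zero          ()

  lookup-last : ∀ (x : A) xs (i : Fin (suc (length xs))) → toℕ i ≡ length xs → lookup (x ∷ xs) i ≡ last x xs
  lookup-last x []       zero    _  = refl
  lookup-last x (y ∷ ys) (suc i) eq = lookup-last y ys i (suc-injective eq)

  last-++ : ∀ (x : A) as u bs → last x (as ++ u ∷ bs) ≡ last u bs
  last-++ x []       u bs = refl
  last-++ x (a ∷ as) u bs = last-++ a as u bs

  chain-++ : ∀ {R : A → A → Set} (x : A) as u bs → Chain R x as → R (last x as) u → Chain R u bs →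
             Chain R x (as ++ u ∷ bs)
  chain-++ x []       u bs _            xu chain = xu , chain
  chain-++ x (a ∷ as) u bs (xa , chain) au rest  = xa , chain-++ a as u bs chain au rest

  chain-++⁻ : ∀ {R : A → A → Set} (x : A) as u bs → Chain R x (as ++ u ∷ bs) →
              Chain R x as × R (last x as) u × Chain R u bs
  chain-++⁻ x []       u bs (xu , chain) = tt , xu , chain
  chain-++⁻ x (a ∷ as) u bs (xa , chain) with chain-++⁻ a as u bs chain
  ... | front , au , back = (xa , front) , au , back

isOdd : ℕ → Bool
isOdd zero    = false
isOdd (suc n) = not (isOdd n)

keepIf : Bool → ℕ → ℕ
keepIf true  k = k
keepIf false _ = 0

keepIf-0 : ∀ b → keepIf b 0 ≡ 0
keepIf-0 true  = refl
keepIf-0 false = refl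

keepIf-< : ∀ {i j} k → i < j → keepIf (i <ᵇ j) k ≡ k
keepIf-< {i} {j} k i<j with i <ᵇ j | <⇒<ᵇ i<j
... | true | _ = refl

keepIf-≥ : ∀ {i j} k → j ≤ i → keepIf (i <ᵇ j) k ≡ 0
keepIf-≥ {i} {j} k j≤i with i <ᵇ j in eq
... | false = refl
... | true  = ⊥-elim (<⇒≱ (<ᵇ⇒< i j (subst T (sym eq) tt)) j≤i)

module _ {n : ℕ} where

  private
    V = Fin n

  _─_ : List V → V → List V
  S ─ v = filter (λ u → ¬? (u ≟ᶠ v)) S

  length-─ : ∀ {v S} → v ∈ S → suc (length (S ─ v)) ≤ length S
  length-─ {v} {S} v∈S = filter-notAll (λ u → ¬? (u ≟ᶠ v)) S (lose v∈S (λ v≢v → v≢v refl))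

  ∈-─ : ∀ {u v S} → u ∈ S → u ≢ v → u ∈ S ─ v
  ∈-─ = ∈-filter⁺ (λ u → ¬? (u ≟ᶠ _))

  degree : (V → V → ℕ) → V → ℕ
  degree w x = sumFin (w x)

  edgeTotal : (V → V → ℕ) → ℕ
  edgeTotal w = sumFin λ x → sumFin λ y → keepIf (toℕ x <ᵇ toℕ y) (w x y)

  IsEdge : V → V → V → V → Set
  IsEdge a b x y = (x ≡ a × y ≡ b) ⊎ (x ≡ b × y ≡ a)

  isEdge? : ∀ a b x y → Dec (IsEdge a b x y)
  isEdge? a b x y = ((x ≟ᶠ a) ×-dec (y ≟ᶠ b)) ⊎-dec ((x ≟ᶠ b) ×-dec (y ≟ᶠ a))

  IsEdge-flip : ∀ {a b x y} → IsEdge a b x y → IsEdge a b y x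
  IsEdge-flip (inj₁ (x≡a , y≡b)) = inj₂ (y≡b , x≡a)
  IsEdge-flip (inj₂ (x≡b , y≡a)) = inj₁ (y≡a , x≡b)

  opaque
    lower : (V → V → ℕ) → V → V → V → V → ℕ
    lower w a b x y with isEdge? a b x y
    ... | yes _ = pred (w x y)
    ... | no  _ = w x y

    lower-≤ : ∀ w a b x y → lower w a b x y ≤ w x y
    lower-≤ w a b x y with isEdge? a b x y
    ... | yes _ = pred[n]≤n
    ... | no  _ = ≤-refl

    lower-at : ∀ w a b → lower w a b a b ≡ pred (w a b)
    lower-at w a b with isEdge? a b a b
    ... | yes _  = refl
    ... | no  ¬e = ⊥-elim (¬e (inj₁ (refl , refl)))

    lower-off : ∀ w {a b x y} → ¬ IsEdge a b x y → lower w a b x y ≡ w x y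
    lower-off w {a} {b} {x} {y} ¬e with isEdge? a b x y
    ... | yes e = ⊥-elim (¬e e)
    ... | no  _ = refl

    lower-cong : ∀ w {a b x y a′ b′ x′ y′} → w x y ≡ w x′ y′ →
                 (IsEdge a b x y → IsEdge a′ b′ x′ y′) → (IsEdge a′ b′ x′ y′ → IsEdge a b x y) →
                 lower w a b x y ≡ lower w a′ b′ x′ y′
    lower-cong w {a} {b} {x} {y} {a′} {b′} {x′} {y′} eq to from
      with isEdge? a b x y | isEdge? a′ b′ x′ y′
    ... | yes _  | yes _   = cong pred eq
    ... | no  _  | no  _   = eq
    ... | yes e  | no  ¬e′ = ⊥-elim (¬e′ (to e))
    ... | no  ¬e | yes e′  = ⊥-elim (¬e (from e′))

  lower-sym : ∀ w → (∀ x y → w x y ≡ w y x) → ∀ a b x y → lower w a b x y ≡ lower w a b y x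
  lower-sym w w-sym a b x y = lower-cong w {a} {b} {x} {y} {a} {b} {y} {x} (w-sym x y) IsEdge-flip IsEdge-flip

  lower-swap : ∀ w a b x y → lower w a b x y ≡ lower w b a x y
  lower-swap w a b x y = lower-cong w {a} {b} {x} {y} {b} {a} {x} {y} refl swap swap

  private
    off-row : ∀ {a b y} → a ≢ b → y ≢ b → ¬ IsEdge a b a y
    off-row a≢b y≢b (inj₁ (_ , y≡b)) = y≢b y≡b
    off-row a≢b y≢b (inj₂ (a≡b , _)) = a≢b a≡b

    suc-pred-at : ∀ w a b → 0 < w a b → w a b ≡ suc (lower w a b a b)
    suc-pred-at w a b pos = trans (sym (suc-pred _ {{>-nonZero pos}})) (cong suc (sym (lower-at w a b)))

  degree-lower : ∀ w {a b} → a ≢ b → 0 < w a b → degree w a ≡ suc (degree (lower w a b) a)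
  degree-lower w {a} {b} a≢b pos =
    sumFin-suc-at b (λ y y≢b → sym (lower-off w (off-row a≢b y≢b))) (suc-pred-at w a b pos)

  degree-lower′ : ∀ w → (∀ x y → w x y ≡ w y x) → ∀ {a b} → a ≢ b → 0 < w a b →
                  degree w b ≡ suc (degree (lower w a b) b)
  degree-lower′ w w-sym {a} {b} a≢b pos = begin
    degree w b                   ≡⟨ degree-lower w (a≢b ∘ sym) (subst (0 <_) (w-sym a b) pos) ⟩
    suc (degree (lower w b a) b) ≡⟨ cong suc (sumFin-cong (lower-swap w b a b)) ⟩
    suc (degree (lower w a b) b) ∎
    where open ≡-Reasoning

  degree-lower-off : ∀ w {a b x} → x ≢ a → x ≢ b → degree (lower w a b) x ≡ degree w x
  degree-lower-off w {a} {b} {x} x≢a x≢b = sumFin-cong λ y → lower-off w {a} {b} {x} {y} λ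
    { (inj₁ (x≡a , _)) → x≢a x≡a ; (inj₂ (x≡b , _)) → x≢b x≡b }

  degree-lower-≤ : ∀ w a b x → degree (lower w a b) x ≤ degree w x
  degree-lower-≤ w a b x = sumFin-mono (lower-≤ w a b x)

  private
    edgeTotal-lower-< : ∀ w {a b} → toℕ a < toℕ b → 0 < w a b →
                        edgeTotal w ≡ suc (edgeTotal (lower w a b))
    edgeTotal-lower-< w {a} {b} a<b pos = sumFin-suc-at a other-row row-a
      where
      a≢b : a ≢ b
      a≢b refl = <-irrefl refl a<b
      other-row : ∀ x → x ≢ a → sumFin (λ y → keepIf (toℕ x <ᵇ toℕ y) (w x y))
                                ≡ sumFin (λ y → keepIf (toℕ x <ᵇ toℕ y) (lower w a b x y))
      other-row x x≢a = sumFin-cong entry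
        where
        entry : ∀ y → keepIf (toℕ x <ᵇ toℕ y) (w x y) ≡ keepIf (toℕ x <ᵇ toℕ y) (lower w a b x y)
        entry y with isEdge? a b x y
        ... | no  ¬e                 = cong (keepIf _) (sym (lower-off w ¬e))
        ... | yes (inj₁ (x≡a , _))   = ⊥-elim (x≢a x≡a)
        ... | yes (inj₂ (refl , refl)) =
          trans (keepIf-≥ _ (<⇒≤ a<b)) (sym (keepIf-≥ _ (<⇒≤ a<b)))
      row-a : sumFin (λ y → keepIf (toℕ a <ᵇ toℕ y) (w a y))
              ≡ suc (sumFin (λ y → keepIf (toℕ a <ᵇ toℕ y) (lower w a b a y)))
      row-a = sumFin-suc-at b (λ y y≢b → cong (keepIf _) (sym (lower-off w (off-row a≢b y≢b))))
        (begin
          keepIf (toℕ a <ᵇ toℕ b) (w a b)                  ≡⟨ keepIf-< _ a<b ⟩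
          w a b                                             ≡⟨ suc-pred-at w a b pos ⟩
          suc (lower w a b a b)                             ≡⟨ cong suc (sym (keepIf-< _ a<b)) ⟩
          suc (keepIf (toℕ a <ᵇ toℕ b) (lower w a b a b))  ∎)
        where open ≡-Reasoning

  edgeTotal-lower : ∀ w → (∀ x y → w x y ≡ w y x) → ∀ {a b} → a ≢ b → 0 < w a b →
                    edgeTotal w ≡ suc (edgeTotal (lower w a b))
  edgeTotal-lower w w-sym {a} {b} a≢b pos with <-cmp (toℕ a) (toℕ b)
  ... | tri< a<b _ _ = edgeTotal-lower-< w a<b pos
  ... | tri≈ _ a≡b _ = ⊥-elim (a≢b (toℕ-injective a≡b))
  ... | tri> _ _ b<a = trans (edgeTotal-lower-< w b<a (subst (0 <_) (w-sym a b) pos))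
      (cong suc (sumFin-cong λ x → sumFin-cong λ y → cong (keepIf _) (lower-swap w b a x y)))

-- Decomposing a 2-matching into paths and cycles

module Decomposition {n : ℕ} (R : Fin n → Fin n → Set)
                     (R-sym : ∀ {x y} → R x y → R y x) (R-irrefl : ∀ {x} → ¬ R x x) where

  private
    V = Fin n

  record TwoMatching : Set where
    field
      weight     : V → V → ℕ
      weight-sym : ∀ x y → weight x y ≡ weight y x
      weight⇒R   : ∀ x y → 0 < weight x y → R x y
      degree≤2   : ∀ x → degree weight x ≤ 2
  open TwoMatching

  lowerM : TwoMatching → V → V → TwoMatching
  lowerM W a b = record
    { weight     = lower (weight W) a b
    ; weight-sym = lower-sym (weight W) (weight-sym W) a b
    ; weight⇒R   = λ x y pos → weight⇒R W x y (≤-trans pos (lower-≤ (weight W) a b x y))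
    ; degree≤2   = λ x → ≤-trans (degree-lower-≤ (weight W) a b x) (degree≤2 W x)
    }

  Path : Set
  Path = V × List V

  IsPath : Path → Set
  IsPath (x , xs) = Chain R x xs

  data Cycle : Set where
    double : V → V → Cycle
    odd    : V → List V → Cycle

  IsCycle : Cycle → Set
  IsCycle (double a b) = R a b
  IsCycle (odd x xs)   = Chain R x xs × R (last x xs) x × isOdd (suc (length xs)) ≡ true

  OnPath : V → Path → Set
  OnPath v (x , xs) = v ∈ x ∷ xs

  OnCycle : V → Cycle → Set
  OnCycle v (double a b) = v ≡ a ⊎ v ≡ b
  OnCycle v (odd x xs)   = v ∈ x ∷ xs

  -- A path on k vertices will occupy k + 1 levels of M(G), a cycle on k vertices k levels.
  pathLevels : Path → ℕ
  pathLevels (x , xs) = 2 + length xs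

  cycleLevels : Cycle → ℕ
  cycleLevels (double _ _) = 2
  cycleLevels (odd x xs)   = suc (length xs)

  levels : List Path → List Cycle → ℕ
  levels ps cs = sum (map pathLevels ps) + sum (map cycleLevels cs)

  SupportedOn : List V → TwoMatching → Set
  SupportedOn S W = ∀ x y → 0 < weight W x y → x ∈ S

  -- A path or a cycle on k vertices accounts for exactly 2k in levels≤: its levels plus its weight.
  record Decomposed (S : List V) (W : TwoMatching) : Set where
    field
      paths     : List Path
      cycles    : List Cycle
      paths-ok  : All IsPath paths
      cycles-ok : All IsCycle cycles
      covers    : ∀ v → v ∈ S → Any (OnPath v) paths ⊎ Any (OnCycle v) cycles
      levels≤   : levels paths cycles + edgeTotal (weight W) ≤ length S + length S

  record TracedFrom (S : List V) (W : TwoMatching) (r : V) : Set where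
    field
      tail       : List V
      end≢r      : last r tail ≢ r
      end-degree : degree (weight W) (last r tail) ≡ 1
      paths      : List Path
      cycles     : List Cycle
      tail-ok    : Chain R r tail
      paths-ok   : All IsPath paths
      cycles-ok  : All IsCycle cycles
      covers     : ∀ v → v ∈ S → v ∈ r ∷ tail ⊎ Any (OnPath v) paths ⊎ Any (OnCycle v) cycles
      levels≤    : levels ((r , tail) ∷ paths) cycles + edgeTotal (weight W) ≤ length S + length S

  close-path : ∀ {S W r} → TracedFrom S W r → Decomposed S W
  close-path {r = r} T = record
    { paths     = (r , tail) ∷ paths
    ; cycles    = cycles
    ; paths-ok  = tail-ok ∷ paths-ok
    ; cycles-ok = cycles-ok
    ; covers    = λ v v∈S → cover (covers v v∈S)
    ; levels≤   = levels≤
    }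
    where
    open TracedFrom T
    cover : ∀ {v} → v ∈ r ∷ tail ⊎ Any (OnPath v) paths ⊎ Any (OnCycle v) cycles →
            Any (OnPath v) ((r , tail) ∷ paths) ⊎ Any (OnCycle v) cycles
    cover (inj₁ on-tail)         = inj₁ (here on-tail)
    cover (inj₂ (inj₁ on-path))  = inj₁ (there on-path)
    cover (inj₂ (inj₂ on-cycle)) = inj₂ on-cycle

  empty : ∀ W → SupportedOn [] W → Decomposed [] W
  empty W supp = record
    { paths = [] ; cycles = [] ; paths-ok = [] ; cycles-ok = [] ; covers = λ _ ()
    ; levels≤ = ≤-reflexive (sumFin-zero λ x → sumFin-zero λ y → no-weight _ x y)
    }
    where
    no-weight : ∀ (b : Bool) x y → keepIf b (weight W x y) ≡ 0
    no-weight b x y with weight W x y in eq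
    ... | zero  = keepIf-0 b
    ... | suc _ with supp x y (subst (0 <_) (sym eq) (s≤s z≤n))
    ...   | ()

  pairs : List V → List Cycle
  pairs (a ∷ b ∷ r) = double a b ∷ pairs r
  pairs _           = []

  pairs-ok : ∀ x xs → Chain R x xs → All IsCycle (pairs (x ∷ xs))
  pairs-ok x []           _              = []
  pairs-ok x (y ∷ [])     (xy , _)       = xy ∷ []
  pairs-ok x (y ∷ z ∷ zs) (xy , _ , rest) = xy ∷ pairs-ok z zs rest

  private
    isOdd-suc-suc : ∀ k → isOdd (suc (suc k)) ≡ isOdd k
    isOdd-suc-suc k = not-involutive (isOdd k)

  pairs-levels : ∀ l → isOdd (length l) ≡ false → sum (map cycleLevels (pairs l)) ≡ length l
  pairs-levels []          _    = refl
  pairs-levels (a ∷ b ∷ r) even = cong (2 +_) (pairs-levels r (trans (sym (isOdd-suc-suc (length r))) even))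

  pairs-cover : ∀ l {u} → isOdd (length l) ≡ false → u ∈ l → Any (OnCycle u) (pairs l)
  pairs-cover (a ∷ b ∷ r) _    (here refl)         = here (inj₁ refl)
  pairs-cover (a ∷ b ∷ r) _    (there (here refl)) = here (inj₂ refl)
  pairs-cover (a ∷ b ∷ r) even (there (there u∈r)) =
    there (pairs-cover r (trans (sym (isOdd-suc-suc (length r))) even) u∈r)

  private
    grow : ∀ d {X L′ L} → X ≤ L′ + L′ → d + L′ ≤ L → d + d + X ≤ L + L
    grow d {X} {L′} {L} X≤ dL′≤L = begin
      d + d + X             ≤⟨ +-monoʳ-≤ (d + d) X≤ ⟩
      d + d + (L′ + L′)     ≡⟨ shuffle d L′ ⟩
      (d + L′) + (d + L′)   ≤⟨ +-mono-≤ dL′≤L dL′≤L ⟩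
      L + L                 ∎
      where
      open ≤-Reasoning
      shuffle : ∀ d L′ → d + d + (L′ + L′) ≡ (d + L′) + (d + L′)
      shuffle = solve-∀

    exactly-2 : ∀ {d} → d ≢ 0 → d ≢ 1 → d ≤ 2 → d ≡ 2
    exactly-2 {0}                 d≢0 _   _ = ⊥-elim (d≢0 refl)
    exactly-2 {1}                 _   d≢1 _ = ⊥-elim (d≢1 refl)
    exactly-2 {2}                 _   _   _ = refl
    exactly-2 {suc (suc (suc _))} _   _   (s≤s (s≤s ()))

    at-most-2 : ∀ {d} → ¬ 3 + d ≤ 2
    at-most-2 (s≤s (s≤s ()))

    R⇒≢ : ∀ {x y} → R x y → x ≢ y
    R⇒≢ xy refl = R-irrefl xy

    positive-degree⇒∈ : ∀ S W x → SupportedOn S W → 0 < degree (weight W) x → x ∈ S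
    positive-degree⇒∈ S W x supp pos with sumFin-positive (weight W x) pos
    ... | y , xy = supp x y xy

    supported-lower : ∀ S W a b → SupportedOn S W → SupportedOn S (lowerM W a b)
    supported-lower S W a b supp x y pos = supp x y (≤-trans pos (lower-≤ (weight W) a b x y))

    supported-─ : ∀ S W v → SupportedOn S W → degree (weight W) v ≡ 0 → SupportedOn (S ─ v) W
    supported-─ S W v supp deg0 x y pos = ∈-─ (supp x y pos) λ { refl →
      <-irrefl refl (≤-trans pos (≤-trans (term≤sumFin (weight W v) y) (≤-reflexive deg0))) }

    neighbour : ∀ W x → 0 < degree (weight W) x → ∃ λ y → 0 < weight W x y
    neighbour W x = sumFin-positive (weight W x)

    shrink : ∀ {S : List V} {v k} → v ∈ S → length S ≤ suc k → length (S ─ v) ≤ k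
    shrink v∈S |S|≤ = ≤-pred (≤-trans (length-─ v∈S) |S|≤)

    empty-fuel : ∀ {S : List V} {v} → v ∈ S → ¬ length S ≤ 0
    empty-fuel v∈S |S|≤0 = n≮0 (≤-trans (length-─ v∈S) |S|≤0)

  add-isolated : ∀ {S W v} → v ∈ S → Decomposed (S ─ v) W → Decomposed S W
  add-isolated {S} {W} {v} v∈S D = record
    { paths     = (v , []) ∷ paths
    ; cycles    = cycles
    ; paths-ok  = tt ∷ paths-ok
    ; cycles-ok = cycles-ok
    ; covers    = cover
    ; levels≤   = ≤-trans (≤-reflexive (count (sum (map pathLevels paths)) (sum (map cycleLevels cycles))
                                              (edgeTotal (weight W))))
                    (grow 1 levels≤ (length-─ v∈S))
    }
    where
    open Decomposed D
    count : ∀ P C E → 2 + P + C + E ≡ 1 + 1 + (P + C + E)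
    count = solve-∀
    cover : ∀ u → u ∈ S → Any (OnPath u) ((v , []) ∷ paths) ⊎ Any (OnCycle u) cycles
    cover u u∈S with u ≟ᶠ v
    ... | yes refl = inj₁ (here (here refl))
    ... | no  u≢v with covers u (∈-─ u∈S u≢v)
    ...   | inj₁ on-path  = inj₁ (there on-path)
    ...   | inj₂ on-cycle = inj₂ on-cycle

  end-path : ∀ {S W W′ r b} → r ∈ S → b ∈ S ─ r → R r b →
             edgeTotal (weight W) ≡ suc (edgeTotal (weight W′)) → degree (weight W) b ≡ 1 →
             Decomposed ((S ─ r) ─ b) W′ → TracedFrom S W r
  end-path {S} {W} {W′} {r} {b} r∈S b∈S′ Rrb total deg-b D = record
    { tail       = b ∷ []
    ; end≢r      = R⇒≢ Rrb ∘ sym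
    ; end-degree = deg-b
    ; paths      = paths
    ; cycles     = cycles
    ; tail-ok    = Rrb , tt
    ; paths-ok   = paths-ok
    ; cycles-ok  = cycles-ok
    ; covers     = cover
    ; levels≤    = ≤-trans (≤-reflexive (trans (cong (levels ((r , b ∷ []) ∷ paths) cycles +_) total)
                     (count (sum (map pathLevels paths)) (sum (map cycleLevels cycles)) (edgeTotal (weight W′)))))
                     (grow 2 levels≤ (≤-trans (s≤s (length-─ b∈S′)) (length-─ r∈S)))
    }
    where
    open Decomposed D
    count : ∀ P C E → 3 + P + C + suc E ≡ 2 + 2 + (P + C + E)
    count = solve-∀
    cover : ∀ u → u ∈ S → u ∈ r ∷ b ∷ [] ⊎ Any (OnPath u) paths ⊎ Any (OnCycle u) cycles
    cover u u∈S with u ≟ᶠ r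
    ... | yes refl = inj₁ (here refl)
    ... | no  u≢r with u ≟ᶠ b
    ...   | yes refl = inj₁ (there (here refl))
    ...   | no  u≢b  = inj₂ (covers u (∈-─ (∈-─ u∈S u≢r) u≢b))

  extend-path : ∀ {S W W′ r b} → r ∈ S → R r b → edgeTotal (weight W) ≡ suc (edgeTotal (weight W′)) →
                degree (weight W′) r ≡ 0 →
                (∀ {x} → x ≢ r → x ≢ b → degree (weight W′) x ≡ degree (weight W) x) →
                TracedFrom (S ─ r) W′ b → TracedFrom S W r
  extend-path {S} {W} {W′} {r} {b} r∈S Rrb total deg-r unchanged T = record
    { tail       = b ∷ tail
    ; end≢r      = end≢r′
    ; end-degree = trans (sym (unchanged end≢r′ end≢r)) end-degree
    ; paths      = paths
    ; cycles     = cycles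
    ; tail-ok    = Rrb , tail-ok
    ; paths-ok   = paths-ok
    ; cycles-ok  = cycles-ok
    ; covers     = cover
    ; levels≤    = ≤-trans (≤-reflexive (trans (cong (levels ((r , b ∷ tail) ∷ paths) cycles +_) total)
                     (count (pathLevels (b , tail) + sum (map pathLevels paths)) (sum (map cycleLevels cycles))
                            (edgeTotal (weight W′)))))
                     (grow 1 levels≤ (length-─ r∈S))
    }
    where
    open TracedFrom T
    end≢r′ : last b tail ≢ r
    end≢r′ e≡r = 0≢1+n (trans (sym deg-r) (trans (cong (degree (weight W′)) (sym e≡r)) end-degree))
    count : ∀ X C E → suc X + C + suc E ≡ 1 + 1 + (X + C + E)
    count = solve-∀
    cover : ∀ u → u ∈ S → u ∈ r ∷ b ∷ tail ⊎ Any (OnPath u) paths ⊎ Any (OnCycle u) cycles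
    cover u u∈S with u ≟ᶠ r
    ... | yes refl = inj₁ (here refl)
    ... | no  u≢r with covers u (∈-─ u∈S u≢r)
    ...   | inj₁ on-tail   = inj₁ (there on-tail)
    ...   | inj₂ elsewhere = inj₂ elsewhere

  private
    cycle-levels≤ : ∀ {S W W₁ v} (T : TracedFrom S W₁ v) →
                    edgeTotal (weight W) ≡ suc (edgeTotal (weight W₁)) →
                    let open TracedFrom T in
                    ∀ cs → sum (map cycleLevels cs) ≡ suc (length tail) + sum (map cycleLevels cycles) →
                    levels paths cs + edgeTotal (weight W) ≤ length S + length S
    cycle-levels≤ {W₁ = W₁} T total cs eq-cs = ≤-trans (≤-reflexive
      (trans (cong₂ (λ c e → sum (map pathLevels paths) + c + e) eq-cs total)
             (count (length tail) (sum (map pathLevels paths)) (sum (map cycleLevels cycles))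
                    (edgeTotal (weight W₁))))) levels≤
      where
      open TracedFrom T
      count : ∀ t P C E → P + (suc t + C) + suc E ≡ 2 + t + P + C + E
      count = solve-∀

    pairs-++-levels : ∀ l cs → isOdd (length l) ≡ false →
                      sum (map cycleLevels (pairs l ++ cs)) ≡ length l + sum (map cycleLevels cs)
    pairs-++-levels l cs even = begin
      sum (map cycleLevels (pairs l ++ cs))                     ≡⟨ cong sum (map-++ cycleLevels (pairs l) cs) ⟩
      sum (map cycleLevels (pairs l) ++ map cycleLevels cs)     ≡⟨ sum-++ (map cycleLevels (pairs l)) _ ⟩
      sum (map cycleLevels (pairs l)) + sum (map cycleLevels cs) ≡⟨ cong (_+ _) (pairs-levels l even) ⟩
      length l + sum (map cycleLevels cs)                       ∎
      where open ≡-Reasoning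

  close-into-cycle : ∀ {S W W₁ v} (T : TracedFrom S W₁ v) → R (last v (TracedFrom.tail T)) v →
                     edgeTotal (weight W) ≡ suc (edgeTotal (weight W₁)) → Decomposed S W
  close-into-cycle {S} {W} {W₁} {v} T closing total = by-parity (isOdd (suc (length tail))) refl
    where
    open TracedFrom T
    by-parity : ∀ b → isOdd (suc (length tail)) ≡ b → Decomposed S W
    by-parity true odd-length = record
      { paths     = paths
      ; cycles    = odd v tail ∷ cycles
      ; paths-ok  = paths-ok
      ; cycles-ok = (tail-ok , closing , odd-length) ∷ cycles-ok
      ; covers    = λ u u∈S → cover (covers u u∈S)
      ; levels≤   = cycle-levels≤ {W = W} T total (odd v tail ∷ cycles) refl
      }
      where
      cover : ∀ {u} → u ∈ v ∷ tail ⊎ Any (OnPath u) paths ⊎ Any (OnCycle u) cycles →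
              Any (OnPath u) paths ⊎ Any (OnCycle u) (odd v tail ∷ cycles)
      cover (inj₁ on-tail)          = inj₂ (here on-tail)
      cover (inj₂ (inj₁ on-path))  = inj₁ on-path
      cover (inj₂ (inj₂ on-cycle)) = inj₂ (there on-cycle)
    by-parity false even-length = record
      { paths     = paths
      ; cycles    = pairs (v ∷ tail) ++ cycles
      ; paths-ok  = paths-ok
      ; cycles-ok = All.++⁺ (pairs-ok v tail tail-ok) cycles-ok
      ; covers    = λ u u∈S → cover (covers u u∈S)
      ; levels≤   = cycle-levels≤ {W = W} T total (pairs (v ∷ tail) ++ cycles)
                      (pairs-++-levels (v ∷ tail) cycles even-length)
      }
      where
      cover : ∀ {u} → u ∈ v ∷ tail ⊎ Any (OnPath u) paths ⊎ Any (OnCycle u) cycles →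
              Any (OnPath u) paths ⊎ Any (OnCycle u) (pairs (v ∷ tail) ++ cycles)
      cover (inj₁ on-tail)          = inj₂ (Any.++⁺ˡ (pairs-cover (v ∷ tail) even-length on-tail))
      cover (inj₂ (inj₁ on-path))  = inj₁ on-path
      cover (inj₂ (inj₂ on-cycle)) = inj₂ (Any.++⁺ʳ (pairs (v ∷ tail)) on-cycle)

  record LeafEdge (S : List V) (W : TwoMatching) (r : V) : Set where
    field
      next        : V
      R-next      : R r next
      total       : edgeTotal (weight W) ≡ suc (edgeTotal (weight (lowerM W r next)))
      r-isolated  : degree (weight (lowerM W r next)) r ≡ 0
      next-degree : degree (weight W) next ≡ suc (degree (weight (lowerM W r next)) next)
      next∈       : next ∈ S ─ r
      supported   : SupportedOn (S ─ r) (lowerM W r next)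

  leaf-edge : ∀ S W {r} → SupportedOn S W → degree (weight W) r ≡ 1 → LeafEdge S W r
  leaf-edge S W {r} supp deg1 = record
    { next        = b
    ; R-next      = Rrb
    ; total       = edgeTotal-lower (weight W) (weight-sym W) r≢b rb>0
    ; r-isolated  = r-isolated
    ; next-degree = degree-lower′ (weight W) (weight-sym W) r≢b rb>0
    ; next∈       = ∈-─ (supp b r (subst (0 <_) (weight-sym W r b) rb>0)) (r≢b ∘ sym)
    ; supported   = supported-─ S (lowerM W r b) r (supported-lower S W r b supp) r-isolated
    }
    where
    b : V
    b = proj₁ (neighbour W r (subst (0 <_) (sym deg1) (s≤s z≤n)))
    rb>0 : 0 < weight W r b
    rb>0 = proj₂ (neighbour W r (subst (0 <_) (sym deg1) (s≤s z≤n)))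
    Rrb : R r b
    Rrb = weight⇒R W r b rb>0
    r≢b : r ≢ b
    r≢b = R⇒≢ Rrb
    r-isolated : degree (weight (lowerM W r b)) r ≡ 0
    r-isolated = suc-injective (trans (sym (degree-lower (weight W) r≢b rb>0)) deg1)

  mutual
    decompose′ : ∀ k S W → length S ≤ k → SupportedOn S W → Decomposed S W
    decompose′ k S W |S|≤k supp =
      by-degrees k S W |S|≤k supp (any? (λ v → degree (weight W) v ≟ 0) S)
                                  (any? (λ v → degree (weight W) v ≟ 1) S)

    by-degrees : ∀ k S W → length S ≤ k → SupportedOn S W →
                 Dec (Any (λ v → degree (weight W) v ≡ 0) S) → Dec (Any (λ v → degree (weight W) v ≡ 1) S) →
                 Decomposed S W
    by-degrees k S W |S|≤k supp (yes isolated) _          = isolate k S W |S|≤k supp (find isolated)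
    by-degrees k S W |S|≤k supp (no _)         (yes leaf) = from-leaf k S W |S|≤k supp (find leaf)
    by-degrees k S W |S|≤k supp (no none₀)     (no none₁) = all-cycles k S W |S|≤k supp λ v v∈S →
      exactly-2 (none₀ ∘ lose v∈S) (none₁ ∘ lose v∈S) (degree≤2 W v)

    isolate : ∀ k S W → length S ≤ k → SupportedOn S W → (∃ λ v → v ∈ S × degree (weight W) v ≡ 0) →
              Decomposed S W
    isolate zero    S W |S|≤k _    (_ , v∈S , _)    = ⊥-elim (empty-fuel v∈S |S|≤k)
    isolate (suc k) S W |S|≤k supp (v , v∈S , deg0) =
      add-isolated v∈S (decompose′ k (S ─ v) W (shrink v∈S |S|≤k) (supported-─ S W v supp deg0))

    from-leaf : ∀ k S W → length S ≤ k → SupportedOn S W → (∃ λ v → v ∈ S × degree (weight W) v ≡ 1) →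
                Decomposed S W
    from-leaf k S W |S|≤k supp (v , v∈S , deg1) = close-path (trace k S W |S|≤k supp v∈S deg1)

    trace : ∀ k S W {r} → length S ≤ k → SupportedOn S W → r ∈ S → degree (weight W) r ≡ 1 →
            TracedFrom S W r
    trace zero    S W |S|≤k _    r∈S _    = ⊥-elim (empty-fuel r∈S |S|≤k)
    trace (suc k) S W |S|≤k supp r∈S deg1 =
      follow k S W (shrink r∈S |S|≤k) r∈S (leaf-edge S W supp deg1) _ refl

    follow : ∀ k S W {r} → length (S ─ r) ≤ k → r ∈ S → (E : LeafEdge S W r) →
             let open LeafEdge E in ∀ d → degree (weight (lowerM W r next)) next ≡ d → TracedFrom S W r
    follow k S W {r} |S′|≤k r∈S E zero deg0 =
      end-path r∈S next∈ R-next total (trans next-degree (cong suc deg0))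
        (decompose′ k ((S ─ r) ─ next) (lowerM W r next)
          (≤-trans (n≤1+n _) (≤-trans (length-─ next∈) |S′|≤k))
          (supported-─ (S ─ r) (lowerM W r next) next supported deg0))
      where open LeafEdge E
    follow k S W {r} |S′|≤k r∈S E 1 deg1 =
      extend-path r∈S R-next total r-isolated (degree-lower-off (weight W))
        (trace k (S ─ r) (lowerM W r next) |S′|≤k supported next∈ deg1)
      where open LeafEdge E
    follow k S W _ _ E (suc (suc d)) deg =
      ⊥-elim (at-most-2 (subst (_≤ 2) (trans next-degree (cong suc deg)) (degree≤2 W next)))
      where open LeafEdge E

    -- Removing one unit of weight from an edge va leaves v as the end of a path, whose other
    -- end can only be a; closing the path with va gives a cycle.
    all-cycles : ∀ k S W → length S ≤ k → SupportedOn S W → (∀ v → v ∈ S → degree (weight W) v ≡ 2) →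
                 Decomposed S W
    all-cycles k []       W _     supp _    = empty W supp
    all-cycles k (v ∷ S′) W |S|≤k supp deg2 = close-into-cycle traced closing total
      where
      S : List V
      S = v ∷ S′
      a : V
      a = proj₁ (neighbour W v (subst (0 <_) (sym (deg2 v (here refl))) (s≤s z≤n)))
      va>0 : 0 < weight W v a
      va>0 = proj₂ (neighbour W v (subst (0 <_) (sym (deg2 v (here refl))) (s≤s z≤n)))
      Rva : R v a
      Rva = weight⇒R W v a va>0
      v≢a : v ≢ a
      v≢a = R⇒≢ Rva
      W₁ : TwoMatching
      W₁ = lowerM W v a
      total : edgeTotal (weight W) ≡ suc (edgeTotal (weight W₁))
      total = edgeTotal-lower (weight W) (weight-sym W) v≢a va>0
      supp₁ : SupportedOn S W₁
      supp₁ = supported-lower S W v a supp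
      traced : TracedFrom S W₁ v
      traced = trace k S W₁ |S|≤k supp₁ (here refl)
                 (suc-injective (trans (sym (degree-lower (weight W) v≢a va>0)) (deg2 v (here refl))))
      open TracedFrom traced
      end≡a : last v tail ≡ a
      end≡a with last v tail ≟ᶠ a
      ... | yes e≡a = e≡a
      ... | no  e≢a = ⊥-elim (2≢1 (trans (sym (trans (degree-lower-off (weight W) end≢r e≢a) (deg2 _ end∈S)))
                                         end-degree))
        where
        2≢1 : 2 ≢ 1
        2≢1 ()
        end∈S : last v tail ∈ S
        end∈S = positive-degree⇒∈ S W₁ _ supp₁ (subst (0 <_) (sym end-degree) (s≤s z≤n))
      closing : R (last v tail) v
      closing = subst (λ e → R e v) (sym end≡a) (R-sym Rva)

  decompose : ∀ W → Decomposed (allFin n) W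
  decompose W = decompose′ n (allFin n) W (≤-reflexive (length-tabulate id)) (λ x _ _ → ∈-allFin x)

-- A levelling of M(G) from a sequence of classes

module Classes {n : ℕ} (G : Graph n) where

  private
    V = Fin n

  Class : Set
  Class = List (Kind n × Bool)

  Independent : Class → Set
  Independent c = ∀ {p q} → p ∈ c → q ∈ c → proj₁ p ≢ proj₁ q →
                  ¬ KClose G (proj₁ p) (proj₁ q) × proj₂ p ≢ proj₂ q

  Rising : Class → Class → Set
  Rising c d = ∀ {p q} → p ∈ c → q ∈ d → KAdj G (proj₁ p) (proj₁ q) →
               proj₂ p ≡ false × proj₂ q ≡ true

  AllUpper : Class → Set
  AllUpper c = ∀ {p} → p ∈ c → proj₂ p ≡ true

  Occurs : Kind n → List Class → Set
  Occurs k = Any (Any ((k ≡_) ∘ proj₁))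

  module FromClasses (c₀ : Class) (L : List Class) (independent : All Independent (c₀ ∷ L))
                     (rising : Chain Rising c₀ L) (top : AllUpper (last c₀ L))
                     (occurs : ∀ k → Occurs k (c₀ ∷ L)) where

    slot : Kind n → Fin (suc (length L))
    slot k = Any.index (occurs k)

    class : Kind n → Class
    class k = lookup (c₀ ∷ L) (slot k)

    private
      entry-∈ : ∀ {c : Class} {k} (e : ∃ λ p → p ∈ c × k ≡ proj₁ p) → (k , proj₂ (proj₁ e)) ∈ c
      entry-∈ ((_ , b) , p∈c , refl) = p∈c

      entry : ∀ k → ∃ λ p → p ∈ class k × k ≡ proj₁ p
      entry k = find (Any.lookup-index (occurs k))

    side : Kind n → Bool
    side k = proj₂ (proj₁ (entry k))

    in-class : ∀ k → (k , side k) ∈ class k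
    in-class k = entry-∈ (entry k)

    same-class : ∀ k k′ → toℕ (slot k) ≡ toℕ (slot k′) → class k ≡ class k′
    same-class k k′ eq = cong (lookup (c₀ ∷ L)) (toℕ-injective eq)

    class-independent : ∀ k → Independent (class k)
    class-independent k = All.lookup independent (∈-lookup (slot k))

    twins : ∀ k k′ → toℕ (slot k) ≡ toℕ (slot k′) → k ≢ k′ → ¬ KClose G k k′ × side k ≢ side k′
    twins k k′ eq k≢k′ =
      class-independent k′ (subst ((k , side k) ∈_) (same-class k k′ eq) (in-class k)) (in-class k′) k≢k′

    no-loop : ∀ x → ¬ Close (M G) x x
    no-loop x (inj₁ xx)        = subst T (adjK-irr G (kind x)) xx
    no-loop x (inj₂ (x≢x , _)) = x≢x refl

    levelling : Levelling (M G) (length L)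
    levelling = record
      { level        = toℕ ∘ slot ∘ kind
      ; upper        = side ∘ kind
      ; level≤       = λ x → ≤-pred (toℕ<n (slot (kind x)))
      ; close⇒level≢ = close⇒level≢
      ; climb        = λ x y xy step → lookup-chain c₀ L (slot (kind x)) (slot (kind y)) step rising
                                         (in-class (kind x)) (in-class (kind y)) xy
      ; twins        = λ x y eq x≢y → proj₂ (twins (kind x) (kind y) eq (x≢y ∘ kind-injective x y))
      ; top⇒upper    = λ x eq → top (subst ((kind x , side (kind x)) ∈_)
                                            (lookup-last c₀ L (slot (kind x)) eq) (in-class (kind x)))
      }
      where
      close⇒level≢ : ∀ x y → Close (M G) x y → toℕ (slot (kind x)) ≢ toℕ (slot (kind y))
      close⇒level≢ x y close eq with x ≟ᶠ y
      ... | yes refl = no-loop x close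
      ... | no  x≢y  = proj₁ (twins (kind x) (kind y) eq (x≢y ∘ kind-injective x y)) (Close⇒KClose G close)

  pathStart pathEnd : V → Class
  pathStart z = (orig z , true) ∷ []
  pathEnd   z = (copy z , false) ∷ []

  hubClass : Class
  hubClass = (hub , true) ∷ []

  pair flipped : V → V → Class
  pair    y x = (orig y , true)  ∷ (copy x , false) ∷ []
  flipped x y = (orig x , false) ∷ (copy y , true)  ∷ []

  loopless : ∀ x → ¬ Adj G x x
  loopless x = subst T (irrefl G x)

  Far-sym : ∀ {x y} → Far G x y → Far G y x
  Far-sym {x} {y} (x≢y , x≁y , no-common) =
    (x≢y ∘ sym) , (x≁y ∘ adj-swap G) , λ { (z , yz , zx) → no-common (z , adj-swap G zx , adj-swap G yz) }

  Far⇒≁ : ∀ {x y} → Far G x y → ¬ Adj G x y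
  Far⇒≁ (_ , x≁y , _) = x≁y

  single-independent : ∀ p → Independent (p ∷ [])
  single-independent p (here refl) (here refl) k≢k = ⊥-elim (k≢k refl)

  KClose-sym : ∀ {k k′} → KClose G k k′ → KClose G k′ k
  KClose-sym {k} {k′} (inj₁ kk′) = inj₁ (kadj-swap G k k′ kk′)
  KClose-sym {k} {k′} (inj₂ (k≢k′ , k≁k′ , m , km , mk′)) =
    inj₂ ((k≢k′ ∘ sym) , (k≁k′ ∘ kadj-swap G k′ k) , m , kadj-swap G m k′ mk′ , kadj-swap G k m km)

  two-independent : ∀ {k₁ k₂ b₁ b₂} → ¬ KClose G k₁ k₂ → b₁ ≢ b₂ →
                    Independent ((k₁ , b₁) ∷ (k₂ , b₂) ∷ [])
  two-independent apart b₁≢b₂ (here refl)         (here refl)         k≢k = ⊥-elim (k≢k refl)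
  two-independent apart b₁≢b₂ (here refl)         (there (here refl)) _   = apart , b₁≢b₂
  two-independent apart b₁≢b₂ (there (here refl)) (here refl)         _   =
    (apart ∘ KClose-sym) , (b₁≢b₂ ∘ sym)
  two-independent apart b₁≢b₂ (there (here refl)) (there (here refl)) k≢k = ⊥-elim (k≢k refl)

  Far⇒¬KClose : ∀ {y x} → Far G y x → ¬ KClose G (orig y) (copy x)
  Far⇒¬KClose far                       (inj₁ yx)                          = Far⇒≁ far yx
  Far⇒¬KClose (_ , _ , no-common)       (inj₂ (_ , _ , orig l , yl , lx)) = no-common (l , yl , lx)

  pair-independent : ∀ {y x} → Far G y x → Independent (pair y x)
  pair-independent far = two-independent (Far⇒¬KClose far) λ ()

  flipped-independent : ∀ {x y} → Far G x y → Independent (flipped x y)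
  flipped-independent far = two-independent (Far⇒¬KClose far) λ ()

  Precedes : V → Class → Set
  Precedes x c = ∀ {z} → ¬ Adj G x z → Rising c (pair z x)

  start-precedes : ∀ x → Precedes x (pathStart x)
  start-precedes x x≁z (here refl) (here refl)         xz = ⊥-elim (x≁z xz)
  start-precedes x x≁z (here refl) (there (here refl)) xx = ⊥-elim (loopless x xx)

  pair-pair : ∀ {x w c d} → ¬ Adj G x c → ¬ Adj G x d → Rising (pair x w) (pair c d)
  pair-pair x≁c x≁d (here refl)         (here refl)         xc = ⊥-elim (x≁c xc)
  pair-pair x≁c x≁d (here refl)         (there (here refl)) xd = ⊥-elim (x≁d xd)
  pair-pair x≁c x≁d (there (here refl)) (here refl)         _  = refl , refl
  pair-pair x≁c x≁d (there (here refl)) (there (here refl)) ()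

  pair-precedes : ∀ y x → Precedes y (pair y x)
  pair-precedes y x y≁z = pair-pair y≁z (loopless y)

  start-end : ∀ x → Rising (pathStart x) (pathEnd x)
  start-end x (here refl) (here refl) xx = ⊥-elim (loopless x xx)

  pair-end : ∀ y x → Rising (pair y x) (pathEnd y)
  pair-end y x (here refl) (here refl) yy = ⊥-elim (loopless y yy)
  pair-end y x (there (here refl)) (here refl) ()

  end-start : ∀ z a → Rising (pathEnd z) (pathStart a)
  end-start z a (here refl) (here refl) _ = refl , refl

  end-pair : ∀ z a b → Rising (pathEnd z) (pair a b)
  end-pair z a b (here refl) (here refl) _ = refl , refl
  end-pair z a b (here refl) (there (here refl)) ()

  end-hub : ∀ z → Rising (pathEnd z) hubClass
  end-hub z (here refl) (here refl) _ = refl , refl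

  pair-hub : ∀ a b → Rising (pair a b) hubClass
  pair-hub a b (there (here refl)) (here refl) _ = refl , refl
  pair-hub a b (here refl)         (here refl) ()

  pair-flipped : ∀ a b → ¬ Adj G b a → Rising (pair b a) (flipped a b)
  pair-flipped a b b≁a (here refl)         (here refl)         ba = ⊥-elim (b≁a ba)
  pair-flipped a b b≁a (here refl)         (there (here refl)) bb = ⊥-elim (loopless b bb)
  pair-flipped a b b≁a (there (here refl)) (here refl)         aa = ⊥-elim (loopless a aa)
  pair-flipped a b b≁a (there (here refl)) (there (here refl)) ()

  flipped-pair : ∀ {a b c d} → ¬ Adj G a d → ¬ Adj G b c → Rising (flipped a b) (pair c d)
  flipped-pair a≁d b≁c (here refl)         (here refl)         _  = refl , refl
  flipped-pair a≁d b≁c (here refl)         (there (here refl)) ad = ⊥-elim (a≁d ad)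
  flipped-pair a≁d b≁c (there (here refl)) (here refl)         bc = ⊥-elim (b≁c bc)
  flipped-pair a≁d b≁c (there (here refl)) (there (here refl)) ()

  pathPairs : V → List V → List Class
  pathPairs x []       = pathEnd x ∷ []
  pathPairs x (y ∷ ys) = pair y x ∷ pathPairs y ys

  pathClasses : V → List V → List Class
  pathClasses x xs = pathStart x ∷ pathPairs x xs

  pathPairs-chain : ∀ {c} x ys rest → Precedes x c → Rising c (pathEnd x) → Chain (Far G) x ys →
                    Chain Rising (pathEnd (last x ys)) rest → Chain Rising c (pathPairs x ys ++ rest)
  pathPairs-chain x []       rest _    c→end _            then = c→end , then
  pathPairs-chain x (y ∷ ys) rest prec _     (xy , chain) then =
    prec (Far⇒≁ xy) , pathPairs-chain y ys rest (pair-precedes y x) (pair-end y x) chain then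

  pathClasses-chain : ∀ {c} x xs rest → Rising c (pathStart x) → Chain (Far G) x xs →
                      Chain Rising (pathEnd (last x xs)) rest → Chain Rising c (pathClasses x xs ++ rest)
  pathClasses-chain x xs rest c→start chain then =
    c→start , pathPairs-chain x xs rest (start-precedes x) (start-end x) chain then

  pathPairs-orig : ∀ x ys {u} → u ∈ ys → Occurs (orig u) (pathPairs x ys)
  pathPairs-orig x (y ∷ ys) (here refl) = here (here refl)
  pathPairs-orig x (y ∷ ys) (there u∈ys) = there (pathPairs-orig y ys u∈ys)

  pathPairs-copy : ∀ x ys {u} → u ∈ x ∷ ys → Occurs (copy u) (pathPairs x ys)
  pathPairs-copy x []       (here refl)  = here (here refl)
  pathPairs-copy x (y ∷ ys) (here refl)  = here (there (here refl))
  pathPairs-copy x (y ∷ ys) (there u∈ys) = there (pathPairs-copy y ys u∈ys)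

  pathClasses-orig : ∀ x xs {u} → u ∈ x ∷ xs → Occurs (orig u) (pathClasses x xs)
  pathClasses-orig x xs (here refl)  = here (here refl)
  pathClasses-orig x xs (there u∈xs) = there (pathPairs-orig x xs u∈xs)

  pathClasses-copy : ∀ x xs {u} → u ∈ x ∷ xs → Occurs (copy u) (pathClasses x xs)
  pathClasses-copy x xs u∈ = there (pathPairs-copy x xs u∈)

  pathPairs-independent : ∀ x ys → Chain (Far G) x ys → All Independent (pathPairs x ys)
  pathPairs-independent x []       _            = single-independent _ ∷ []
  pathPairs-independent x (y ∷ ys) (xy , chain) = pair-independent (Far-sym xy) ∷ pathPairs-independent y ys chain

  pathClasses-independent : ∀ x xs → Chain (Far G) x xs → All Independent (pathClasses x xs)
  pathClasses-independent x xs chain = single-independent _ ∷ pathPairs-independent x xs chain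

  pathPairs-length : ∀ x ys → length (pathPairs x ys) ≡ suc (length ys)
  pathPairs-length x []       = refl
  pathPairs-length x (y ∷ ys) = cong suc (pathPairs-length y ys)

  cyclePairs : V → V → List V → List Class
  cyclePairs first x []       = pair first x ∷ []
  cyclePairs first x (z ∷ zs) = pair z x ∷ cyclePairs first z zs

  cycleClasses : V → V → List V → List Class
  cycleClasses x y ys = pair y x ∷ cyclePairs x y ys

  cyclePairs-chain : ∀ {c} first x zs rest → Precedes x c → Chain (Far G) x zs → Far G (last x zs) first →
                     Chain Rising (pair first (last x zs)) rest → Chain Rising c (cyclePairs first x zs ++ rest)
  cyclePairs-chain first x []       rest prec _            closing then = prec (Far⇒≁ closing) , then
  cyclePairs-chain first x (z ∷ zs) rest prec (xz , chain) closing then =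
    prec (Far⇒≁ xz) , cyclePairs-chain first z zs rest (pair-precedes z x) chain closing then

  cyclePairs-orig : ∀ first x zs {u} → u ∈ first ∷ zs → Occurs (orig u) (cyclePairs first x zs)
  cyclePairs-orig first x []       (here refl)           = here (here refl)
  cyclePairs-orig first x (z ∷ zs) (here refl)           = there (cyclePairs-orig first z zs (here refl))
  cyclePairs-orig first x (z ∷ zs) (there (here refl))   = here (here refl)
  cyclePairs-orig first x (z ∷ zs) (there (there u∈zs)) = there (cyclePairs-orig first z zs (there u∈zs))

  cyclePairs-copy : ∀ first x zs {u} → u ∈ x ∷ zs → Occurs (copy u) (cyclePairs first x zs)
  cyclePairs-copy first x []       (here refl)  = here (there (here refl))
  cyclePairs-copy first x (z ∷ zs) (here refl)  = here (there (here refl))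
  cyclePairs-copy first x (z ∷ zs) (there u∈zs) = there (cyclePairs-copy first z zs u∈zs)

  cycleClasses-orig : ∀ x y ys {u} → u ∈ x ∷ y ∷ ys → Occurs (orig u) (cycleClasses x y ys)
  cycleClasses-orig x y ys (here refl)          = there (cyclePairs-orig x y ys (here refl))
  cycleClasses-orig x y ys (there (here refl))  = here (here refl)
  cycleClasses-orig x y ys (there (there u∈ys)) = there (cyclePairs-orig x y ys (there u∈ys))

  cycleClasses-copy : ∀ x y ys {u} → u ∈ x ∷ y ∷ ys → Occurs (copy u) (cycleClasses x y ys)
  cycleClasses-copy x y ys (here refl) = here (there (here refl))
  cycleClasses-copy x y ys (there u∈)  = there (cyclePairs-copy x y ys u∈)

  cyclePairs-independent : ∀ first x zs → Chain (Far G) x zs → Far G (last x zs) first →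
                           All Independent (cyclePairs first x zs)
  cyclePairs-independent first x []       _            closing = pair-independent (Far-sym closing) ∷ []
  cyclePairs-independent first x (z ∷ zs) (xz , chain) closing =
    pair-independent (Far-sym xz) ∷ cyclePairs-independent first z zs chain closing

  cyclePairs-length : ∀ first x zs → length (cyclePairs first x zs) ≡ suc (length zs)
  cyclePairs-length first x []       = refl
  cyclePairs-length first x (z ∷ zs) = cong suc (cyclePairs-length first z zs)

-- The levelling of M(G) from a maximum 2-matching

module BaseLevelling {n : ℕ} (G : Graph n) where

  open Classes G

  private
    V = Fin n

    T-true : ∀ {b} → b ≡ true → T b
    T-true refl = tt

  open Decomposition (Far G) Far-sym (λ far → proj₁ far refl) public

  Touches : V → V → V → Set
  Touches y₁ y₂ u = Adj G u y₁ ⊎ Adj G u y₂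

  -- Far vertices have no common neighbour, so at most one of them is adjacent to y₁,
  -- and at most one to y₂.
  alternate : ∀ {y₁ y₂ p q} → Far G p q → Touches y₁ y₂ p → Touches y₁ y₂ q →
              adj G q y₁ ≡ not (adj G p y₁)
  alternate {y₁} {y₂} {p} {q} (_ , _ , no-common) tp tq with adj G p y₁ in e₁ | adj G q y₁ in e₂
  ... | true  | true  = ⊥-elim (no-common (y₁ , T-true e₁ , adj-swap G (T-true e₂)))
  ... | true  | false = refl
  ... | false | true  = refl
  ... | false | false with tp | tq
  ...   | inj₂ py₂ | inj₂ qy₂ = ⊥-elim (no-common (y₂ , py₂ , adj-swap G qy₂))

  alternating : ∀ {y₁ y₂} x xs → Chain (Far G) x xs → (∀ {u} → u ∈ x ∷ xs → Touches y₁ y₂ u) →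
                adj G (last x xs) y₁ ≡ adj G x y₁ xor isOdd (length xs)
  alternating {y₁} x []       _            _     = xor-false (adj G x y₁)
    where
    xor-false : ∀ b → b ≡ b xor false
    xor-false true  = refl
    xor-false false = refl
  alternating {y₁} x (y ∷ ys) (xy , chain) touch = begin
    adj G (last y ys) y₁                    ≡⟨ alternating y ys chain (touch ∘ there) ⟩
    adj G y y₁ xor isOdd (length ys)        ≡⟨ cong (_xor isOdd (length ys))
                                                  (alternate xy (touch (here refl)) (touch (there (here refl)))) ⟩
    not (adj G x y₁) xor isOdd (length ys)  ≡⟨ sym (not-distribˡ-xor (adj G x y₁) (isOdd (length ys))) ⟩
    not (adj G x y₁ xor isOdd (length ys))  ≡⟨ not-distribʳ-xor (adj G x y₁) (isOdd (length ys)) ⟩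
    adj G x y₁ xor not (isOdd (length ys))  ∎
    where open ≡-Reasoning

  odd-cycle-escapes : ∀ {y₁ y₂} x xs → Chain (Far G) x xs → Far G (last x xs) x →
                      isOdd (suc (length xs)) ≡ true → ¬ (∀ {u} → u ∈ x ∷ xs → Touches y₁ y₂ u)
  odd-cycle-escapes {y₁} x xs chain closing odd-length touch = not-¬ refl (begin
    adj G x y₁                                 ≡⟨ alternate closing (touch (last-∈ x xs)) (touch (here refl)) ⟩
    not (adj G (last x xs) y₁)                 ≡⟨ cong not (alternating x xs chain touch) ⟩
    not (adj G x y₁ xor isOdd (length xs))     ≡⟨ not-distribʳ-xor (adj G x y₁) (isOdd (length xs)) ⟩
    adj G x y₁ xor isOdd (suc (length xs))     ≡⟨ cong (adj G x y₁ xor_) odd-length ⟩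
    adj G x y₁ xor true                        ≡⟨ xor-true (adj G x y₁) ⟩
    not (adj G x y₁)                           ∎)
    where
    open ≡-Reasoning
    xor-true : ∀ b → b xor true ≡ not b
    xor-true true  = refl
    xor-true false = refl

  escape : ∀ {y₁ y₂} x xs → Chain (Far G) x xs → Far G (last x xs) x → isOdd (suc (length xs)) ≡ true →
           ∃ λ u → u ∈ x ∷ xs × ¬ Adj G u y₁ × ¬ Adj G u y₂
  escape {y₁} {y₂} x xs chain closing odd-length
    with any? (λ u → ¬? (T? (adj G u y₁)) ×-dec ¬? (T? (adj G u y₂))) (x ∷ xs)
  ... | yes found = find found
  ... | no  none  = ⊥-elim (odd-cycle-escapes x xs chain closing odd-length λ u∈ → touches (none ∘ lose u∈))
    where
    touches : ∀ {u} → ¬ (¬ Adj G u y₁ × ¬ Adj G u y₂) → Touches y₁ y₂ u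
    touches {u} h with adj G u y₁ | adj G u y₂
    ... | true  | _     = inj₁ tt
    ... | false | true  = inj₂ tt
    ... | false | false = ⊥-elim (h ((λ ()) , (λ ())))

  orientation : ∀ {a b y₁ y₂} → Far G a b → Far G y₁ y₂ →
                (¬ Adj G a y₁ × ¬ Adj G b y₂) ⊎ (¬ Adj G b y₁ × ¬ Adj G a y₂)
  orientation {a} {b} {y₁} {y₂} (_ , _ , apart) (_ , _ , apart′)
    with adj G a y₁ in e₁ | adj G b y₂ in e₂ | adj G b y₁ in e₃ | adj G a y₂ in e₄
  ... | false | false | _     | _     = inj₁ ((λ ()) , (λ ()))
  ... | _     | _     | false | false = inj₂ ((λ ()) , (λ ()))
  ... | true  | _     | true  | _     = ⊥-elim (apart  (y₁ , T-true e₁ , adj-swap G (T-true e₃)))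
  ... | true  | _     | _     | true  = ⊥-elim (apart′ (a , adj-swap G (T-true e₁) , T-true e₄))
  ... | _     | true  | true  | _     = ⊥-elim (apart′ (b , adj-swap G (T-true e₃) , T-true e₂))
  ... | _     | true  | _     | true  = ⊥-elim (apart  (y₂ , T-true e₄ , adj-swap G (T-true e₂)))

  record Rotation (x : V) (xs : List V) (u : V) : Set where
    constructor rotation
    field
      tail          : List V
      tail-chain    : Chain (Far G) u tail
      closing       : Far G (last u tail) u
      same-vertices : ∀ {v} → v ∈ x ∷ xs → v ∈ u ∷ tail
      same-length   : length tail ≡ length xs

  rotate : ∀ x xs {u} → Chain (Far G) x xs → Far G (last x xs) x → u ∈ x ∷ xs → Rotation x xs u
  rotate x xs chain closing (here refl) = record
    { tail = xs ; tail-chain = chain ; closing = closing ; same-vertices = id ; same-length = refl }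
  rotate x xs {u} chain closing (there u∈xs) with ∈-∃++ u∈xs
  ... | as , bs , refl with chain-++⁻ x as u bs chain
  ...   | front , au , back = record
    { tail          = bs ++ x ∷ as
    ; tail-chain    = chain-++ u bs x as back (subst (λ e → Far G e x) (last-++ x as u bs) closing) front
    ; closing       = subst (λ e → Far G e u) (sym (last-++ u bs x as)) au
    ; same-vertices = moved
    ; same-length   = trans (length-++-comm bs (x ∷ as)) (sym (length-++-sucʳ as u bs))
    }
    where
    moved : ∀ {v} → v ∈ x ∷ as ++ u ∷ bs → v ∈ u ∷ bs ++ x ∷ as
    moved (here refl) = there (∈-++⁺ʳ bs (here refl))
    moved (there v∈) with ∈-++⁻ as v∈
    ... | inj₁ v∈as          = there (∈-++⁺ʳ bs (there v∈as))
    ... | inj₂ (here refl)   = here refl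
    ... | inj₂ (there v∈bs)  = there (∈-++⁺ˡ v∈bs)

  data Head (d : Class) : Set where
    ends      : d ≡ hubClass → Head d
    continues : ∀ {y₁ y₂} → Far G y₁ y₂ → d ≡ pair y₂ y₁ → Head d

  end-head : ∀ {d} → Head d → ∀ z → Rising (pathEnd z) d
  end-head (ends e)        z = subst (Rising (pathEnd z)) (sym e) (end-hub z)
  end-head (continues _ e) z = subst (Rising (pathEnd z)) (sym e) (end-pair z _ _)

  record CycleBlocks (cs : List Cycle) : Set where
    field
      first       : Class
      rest        : List Class
      head        : Head first
      rising      : Chain Rising first rest
      top         : AllUpper (last first rest)
      independent : All Independent (first ∷ rest)
      hub-occurs  : Occurs hub (first ∷ rest)
      orig-occurs : ∀ {u} → Any (OnCycle u) cs → Occurs (orig u) (first ∷ rest)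
      copy-occurs : ∀ {u} → Any (OnCycle u) cs → Occurs (copy u) (first ∷ rest)
      rest-length : length rest ≡ sum (map cycleLevels cs)
  open CycleBlocks

  no-cycles : CycleBlocks []
  no-cycles = record
    { first = hubClass ; rest = [] ; head = ends refl ; rising = tt ; top = λ { (here refl) → refl }
    ; independent = single-independent _ ∷ [] ; hub-occurs = here (here refl)
    ; orig-occurs = λ () ; copy-occurs = λ () ; rest-length = refl
    }

  prepend : ∀ {C cs} (B : CycleBlocks cs) b bs → Head b → Chain Rising b (bs ++ first B ∷ rest B) →
            All Independent (b ∷ bs) → (∀ {u} → OnCycle u C → Occurs (orig u) (b ∷ bs)) →
            (∀ {u} → OnCycle u C → Occurs (copy u) (b ∷ bs)) → suc (length bs) ≡ cycleLevels C →
            CycleBlocks (C ∷ cs)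
  prepend B b bs b-head b-rising b-independent b-orig b-copy b-length = record
    { first       = b
    ; rest        = bs ++ first B ∷ rest B
    ; head        = b-head
    ; rising      = b-rising
    ; top         = subst AllUpper (sym (last-++ b bs (first B) (rest B))) (top B)
    ; independent = All.++⁺ b-independent (independent B)
    ; hub-occurs  = Any.++⁺ʳ (b ∷ bs) (hub-occurs B)
    ; orig-occurs = λ { (here on) → Any.++⁺ˡ (b-orig on) ; (there on) → Any.++⁺ʳ (b ∷ bs) (orig-occurs B on) }
    ; copy-occurs = λ { (here on) → Any.++⁺ˡ (b-copy on) ; (there on) → Any.++⁺ʳ (b ∷ bs) (copy-occurs B on) }
    ; rest-length = trans (length-++ bs) (trans (+-suc (length bs) _) (cong₂ _+_ b-length (rest-length B)))
    }

  cycle-block : ∀ {C cs} (B : CycleBlocks cs) x y ys → Far G x y → Chain (Far G) y ys → Far G (last y ys) x →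
                Rising (pair x (last y ys)) (first B) → (∀ {u} → OnCycle u C → u ∈ x ∷ y ∷ ys) →
                suc (suc (length ys)) ≡ cycleLevels C → CycleBlocks (C ∷ cs)
  cycle-block B x y ys xy chain closing into on len =
    prepend B (pair y x) (cyclePairs x y ys) (continues xy refl)
      (cyclePairs-chain x y ys (first B ∷ rest B) (pair-precedes y x) chain closing (into , rising B))
      (pair-independent (Far-sym xy) ∷ cyclePairs-independent x y ys chain closing)
      (cycleClasses-orig x y ys ∘ on) (cycleClasses-copy x y ys ∘ on)
      (trans (cong suc (cyclePairs-length x y ys)) len)

  -- Used for a double edge ab when the next block starts with a pair: its second level is
  -- flipped so that only a has to avoid one vertex of that pair and only b the other.
  flipped-block : ∀ {C cs a b} (B : CycleBlocks cs) → Far G a b → Rising (flipped a b) (first B) →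
                  (∀ {u} → OnCycle u C → u ≡ a ⊎ u ≡ b) → 2 ≡ cycleLevels C → CycleBlocks (C ∷ cs)
  flipped-block {a = a} {b} B ab into on len =
    prepend B (pair b a) (flipped a b ∷ []) (continues ab refl)
      (pair-flipped a b (Far⇒≁ (Far-sym ab)) , into , rising B)
      (pair-independent (Far-sym ab) ∷ flipped-independent ab ∷ [])
      (orig-in ∘ on) (copy-in ∘ on) len
    where
    orig-in : ∀ {u} → u ≡ a ⊎ u ≡ b → Occurs (orig u) (pair b a ∷ flipped a b ∷ [])
    orig-in (inj₁ refl) = there (here (here refl))
    orig-in (inj₂ refl) = here (here refl)
    copy-in : ∀ {u} → u ≡ a ⊎ u ≡ b → Occurs (copy u) (pair b a ∷ flipped a b ∷ [])
    copy-in (inj₁ refl) = here (there (here refl))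
    copy-in (inj₂ refl) = there (here (there (here refl)))

  double-block : ∀ {a b cs} → CycleBlocks cs → Far G a b → CycleBlocks (double a b ∷ cs)
  double-block {a} {b} B ab with head B
  ... | ends e = cycle-block B a b [] ab tt (Far-sym ab) (subst (Rising (pair a b)) (sym e) (pair-hub a b))
                   (λ { (inj₁ refl) → here refl ; (inj₂ refl) → there (here refl) }) refl
  ... | continues far e with orientation ab far
  ...   | inj₁ (a≁y₁ , b≁y₂) =
          flipped-block B ab (subst (Rising (flipped a b)) (sym e) (flipped-pair a≁y₁ b≁y₂)) id refl
  ...   | inj₂ (b≁y₁ , a≁y₂) =
          flipped-block B (Far-sym ab) (subst (Rising (flipped b a)) (sym e) (flipped-pair b≁y₁ a≁y₂))
            swap refl

  -- An odd cycle is rotated to start at a vertex adjacent to neither vertex of the next pair.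
  odd-block : ∀ {x xs cs} → CycleBlocks cs → IsCycle (odd x xs) → CycleBlocks (odd x xs ∷ cs)
  odd-block {x} {[]}     B (_ , (x≢x , _) , _) = ⊥-elim (x≢x refl)
  odd-block {x} {y ∷ ys} B ((xy , chain) , closing , odd-length) with head B
  ... | ends e = cycle-block B x y ys xy chain closing
                   (subst (Rising (pair x (last y ys))) (sym e) (pair-hub x (last y ys))) id refl
  ... | continues far e with escape x (y ∷ ys) (xy , chain) closing odd-length
  ...   | u , u∈ , u≁y₁ , u≁y₂ with rotate x (y ∷ ys) (xy , chain) closing u∈
  ...     | rotation (z ∷ zs) (uz , chain′) closing′ same len =
            cycle-block B u z zs uz chain′ closing′
              (subst (Rising (pair u (last z zs))) (sym e) (pair-pair u≁y₂ u≁y₁)) same (cong suc len)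

  cycleBlocks : ∀ cs → All IsCycle cs → CycleBlocks cs
  cycleBlocks []                 []          = no-cycles
  cycleBlocks (double a b ∷ cs) (ab ∷ oks)  = double-block (cycleBlocks cs oks) ab
  cycleBlocks (odd x xs ∷ cs)   (ok ∷ oks)  = odd-block (cycleBlocks cs oks) ok

  pathBlocks : List Path → List Class
  pathBlocks []              = []
  pathBlocks ((x , xs) ∷ ps) = pathClasses x xs ++ pathBlocks ps

  pathBlocks-chain : ∀ {c} ps d ds → (∀ x → Rising c (pathStart x)) → Rising c d → All IsPath ps →
                     (∀ z → Rising (pathEnd z) d) → Chain Rising d ds → Chain Rising c (pathBlocks ps ++ d ∷ ds)
  pathBlocks-chain []              d ds _       c→d _              _     then = c→d , then
  pathBlocks-chain ((x , xs) ∷ ps) d ds c→start _   (chain ∷ oks) end→d then =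
    subst (Chain Rising _) (sym (++-assoc (pathClasses x xs) (pathBlocks ps) (d ∷ ds)))
      (pathClasses-chain x xs (pathBlocks ps ++ d ∷ ds) (c→start x) chain
        (pathBlocks-chain ps d ds (end-start _) (end→d _) oks end→d then))

  pathBlocks-orig : ∀ ps {u} → Any (OnPath u) ps → Occurs (orig u) (pathBlocks ps)
  pathBlocks-orig ((x , xs) ∷ ps) (here on)  = Any.++⁺ˡ (pathClasses-orig x xs on)
  pathBlocks-orig ((x , xs) ∷ ps) (there on) = Any.++⁺ʳ (pathClasses x xs) (pathBlocks-orig ps on)

  pathBlocks-copy : ∀ ps {u} → Any (OnPath u) ps → Occurs (copy u) (pathBlocks ps)
  pathBlocks-copy ((x , xs) ∷ ps) (here on)  = Any.++⁺ˡ (pathClasses-copy x xs on)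
  pathBlocks-copy ((x , xs) ∷ ps) (there on) = Any.++⁺ʳ (pathClasses x xs) (pathBlocks-copy ps on)

  pathBlocks-independent : ∀ ps → All IsPath ps → All Independent (pathBlocks ps)
  pathBlocks-independent []              []            = []
  pathBlocks-independent ((x , xs) ∷ ps) (chain ∷ oks) =
    All.++⁺ (pathClasses-independent x xs chain) (pathBlocks-independent ps oks)

  pathBlocks-length : ∀ ps → length (pathBlocks ps) ≡ sum (map pathLevels ps)
  pathBlocks-length []              = refl
  pathBlocks-length ((x , xs) ∷ ps) = trans (length-++ (pathClasses x xs))
    (cong₂ _+_ (cong suc (pathPairs-length x xs)) (pathBlocks-length ps))

  -- The empty class rises into every class; it stands in for a predecessor of the first one.
  levelling-from-list : ∀ L b → Chain Rising [] L → AllUpper (last [] L) → All Independent L →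
                        (∀ k → Occurs k L) → length L ≡ suc b → Levelling (M G) b
  levelling-from-list []       b _            _   _           occurs _   with occurs hub
  ... | ()
  levelling-from-list (c ∷ L) b (_ , rising) top independent occurs len =
    subst (Levelling (M G)) (suc-injective len) (FromClasses.levelling c L independent rising top occurs)

  decomposition-levelling : ∀ {W} (D : Decomposed (allFin n) W) →
                            Levelling (M G) (levels (Decomposed.paths D) (Decomposed.cycles D))
  decomposition-levelling D =
    levelling-from-list (pathBlocks paths ++ first B ∷ rest B) _ chain
      (subst AllUpper (sym (last-++ [] (pathBlocks paths) (first B) (rest B))) (top B))
      (All.++⁺ (pathBlocks-independent paths paths-ok) (independent B))
      occurs
      (trans (length-++ (pathBlocks paths))
        (trans (+-suc _ _) (cong suc (cong₂ _+_ (pathBlocks-length paths) (rest-length B)))))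
    where
    open Decomposed D
    B : CycleBlocks cycles
    B = cycleBlocks cycles cycles-ok
    chain : Chain Rising [] (pathBlocks paths ++ first B ∷ rest B)
    chain = pathBlocks-chain paths (first B) (rest B) (λ _ ()) (λ ()) paths-ok (end-head (head B)) (rising B)
    occurs : ∀ k → Occurs k (pathBlocks paths ++ first B ∷ rest B)
    occurs hub = Any.++⁺ʳ (pathBlocks paths) (hub-occurs B)
    occurs (orig u) with covers u (∈-allFin u)
    ... | inj₁ on-path  = Any.++⁺ˡ (pathBlocks-orig paths on-path)
    ... | inj₂ on-cycle = Any.++⁺ʳ (pathBlocks paths) (orig-occurs B on-cycle)
    occurs (copy u) with covers u (∈-allFin u)
    ... | inj₁ on-path  = Any.++⁺ˡ (pathBlocks-copy paths on-path)
    ... | inj₂ on-cycle = Any.++⁺ʳ (pathBlocks paths) (copy-occurs B on-cycle)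

  Far? : ∀ x y → Dec (Far G x y)
  Far? x y = ¬? (x ≟ᶠ y) ×-dec ¬? (T? (adj G x y))
             ×-dec ¬? (Finₚ.any? λ z → T? (adj G x z) ×-dec T? (adj G z y))

  two-matching : TwoMatchingCompSq G → TwoMatching
  two-matching m = record
    { weight     = w m
    ; weight-sym = w-sym m
    ; weight⇒R   = supported
    ; degree≤2   = w-vertex m
    }
    where
    supported : ∀ x y → 0 < w m x y → Far G x y
    supported x y pos with Far? x y
    ... | yes far = far
    ... | no  ¬far = ⊥-elim (<-irrefl (sym (w-edge m x y ¬far)) pos)

  size≡edgeTotal : ∀ m → size {G = G} m ≡ edgeTotal (w m)
  size≡edgeTotal m = rows
    where
    -- The summand of size is local to its definition; rows fixes it by unification
    -- before entry is defined by cases.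
    entry : ∀ x y → _ ≡ keepIf (toℕ x <ᵇ toℕ y) (w m x y)
    rows : size m ≡ edgeTotal (w m)
    rows = sumFin-cong λ x → sumFin-cong λ y → entry x y
    entry x y with toℕ x <ᵇ toℕ y
    ... | true  = refl
    ... | false = refl

  levelling-from-2-matching : ∀ p → Nu2CompSq G p → ∃ λ b → b + p ≤ 2 * n × Levelling (M G) b
  levelling-from-2-matching p ((m , size≡p) , _) =
    levels paths cycles , bound , decomposition-levelling D
    where
    D : Decomposed (allFin n) (two-matching m)
    D = decompose (two-matching m)
    open Decomposed D
    bound : levels paths cycles + p ≤ 2 * n
    bound = subst₂ (λ e N → levels paths cycles + e ≤ N)
                   (trans (sym (size≡edgeTotal m)) size≡p)
                   (trans (cong₂ _+_ (length-tabulate {n = n} id) (length-tabulate {n = n} id))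
                          (cong (n +_) (sym (+-identityʳ n))))
                   levels≤

theorem4p7 : ∀ {n} (G : Graph n) (p : ℕ) → 2 ≤ n → Nu2CompSq G p →
    ∀ (t : ℕ) → 2 ≤ t →
    LambdaAtMost (Mpow t G) (2 ^ (t ∸ 1) * (2 * n + 2 ∸ p) ∸ 2)
theorem4p7 G p _ ν₂ (suc (suc k)) _ =
  let (b , b+p≤2n , levelling) = BaseLevelling.levelling-from-2-matching G p ν₂
  in lambda-mono (Mpow (suc (suc k)) G) (height-bound (suc k) b+p≤2n) (lambda-Mpow G levelling k)
theorem4p7 G p _ _ (suc zero) (s≤s ())
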